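{- Let $j\ge1$, let $\Upsilon\subseteq S_j$ be any set of permutations, let $\Upsilon_0=\{(\tau,0^j):\tau\in\Upsilon\}$ (where $0^j$ is the word of $j$ zeros), and let $\Gamma=\Upsilon_0\cup\{(1\text{ - }2,1~0),(2\text{ - }1,1~0)\}$. Then for every $k\ge1$, $$\sum_{n\ge0}Av_{n,k}^{\Gamma}\frac{t^n}{n!}=\Big(\sum_{n\ge0}Av_n^{\Upsilon}\frac{t^n}{n!}\Big)^k$$ as formal power series in $t$.
   Context: For integers $k\ge1$, $n\ge0$, $C_k\wr S_n$ denotes the set of pairs $(\sigma,w)$ where $\sigma=\sigma_1\cdots\sigma_n$ is a permutation of $\{1,\dots,n\}$ in one-line notation and $w=w_1\cdots w_n\in\{0,1,\dots,k-1\}^n$. For a sequence of distinct integers, $\mathrm{red}$ replaces the $i$-th smallest entry by $i$; for a word over nonnegative integers, $\mathrm{red}$ replaces every occurrence of the $i$-th smallest distinct letter by $i-1$. A pattern $(\tau,u)$ has $\tau\in S_m$ and $u$ a word of length $m$ with $\mathrm{red}(u)=u$; e.g. $(2\text{ - }1,1~0)$ means $\tau=21$, $u=10$. $(\tau,u)$ bi-occurs in $(\sigma,w)$ if there are $1\le i_1<\cdots<i_m\le n$ (not necessarily adjacent) with $\mathrm{red}(\sigma_{i_1}\cdots\sigma_{i_m})=\tau$ and $\mathrm{red}(w_{i_1}\cdots w_{i_m})=u$; $(\sigma,w)$ bi-avoids a set of patterns if no member bi-occurs in it. $Av_{n,k}^{\Gamma}$ is the number of elements of $C_k\wr S_n$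 bi-avoiding $\Gamma$ (with $Av_{0,k}^\Gamma=1$). A permutation $\sigma\in S_n$ avoids $\Upsilon$ if there are no indices $i_1<\cdots<i_j$ with $\mathrm{red}(\sigma_{i_1}\cdots\sigma_{i_j})\in\Upsilon$; $Av_n^{\Upsilon}$ is the number of such $\sigma\in S_n$ (with $Av_0^\Upsilon=1$). -}

module Defs where

open import Data.Nat as ℕ using (ℕ; zero; suc; _<?_; _≟_; _!)
open import Data.Nat.Properties using (_!≢0)
open import Data.List using (List; []; _∷_; map; filter; length; replicate; upTo; concatMap; _++_; zip; unzip; deduplicate)
open import Data.Bool.ListAction using (all)
open import Data.Bool.ListAction using (any)
open import Data.List.Properties using (≡-dec)
open import Data.List.Membership.DecPropositional _≟_ using (_∈?_)
open import Data.Product using (_×_; _,_; proj₁; proj₂)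
open import Data.Bool using (Bool; true; false; _∧_; not)
open import Relation.Nullary.Decidable using (⌊_⌋)
open import Data.Integer using (+_)
open import Data.Rational using (ℚ; _/_; 0ℚ; 1ℚ) renaming (_+_ to _+ℚ_; _*_ to _*ℚ_)

words : ℕ → ℕ → List (List ℕ)
words k zero    = [] ∷ []
words k (suc n) = concatMap (λ a → map (a ∷_) (words k n)) (upTo k)

-- S_n : the lists of length n over {1,…,n} containing each of 1,…,n
-- (i.e. the permutations of {1,…,n} in one-line notation)
isPermᵇ : ℕ → List ℕ → Bool
isPermᵇ n σ = all (λ i → ⌊ suc i ∈? σ ⌋) (upTo n)

perms : ℕ → List (List ℕ)
perms n = filter (λ σ → Data.Bool.T? (isPermᵇ n σ)) (map (map suc) (words n n))

wreath : ℕ → ℕ → List (List ℕ × List ℕ)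
wreath k n = concatMap (λ σ → map (σ ,_) (words k n)) (perms n)

redP : List ℕ → List ℕ
redP xs = map (λ x → suc (length (filter (_<? x) xs))) xs

redW : List ℕ → List ℕ
redW xs = map (λ x → length (filter (_<? x) (deduplicate _≟_ xs))) xs

subseqs : {A : Set} → List A → List (List A)
subseqs []       = [] ∷ []
subseqs (x ∷ xs) = map (x ∷_) (subseqs xs) ++ subseqs xs

eqL : List ℕ → List ℕ → Bool
eqL a b = ⌊ ≡-dec _≟_ a b ⌋

biOccurs : List ℕ × List ℕ → List ℕ × List ℕ → Bool
biOccurs (τ , u) (σ , w) =
  any (λ s → eqL (redP (proj₁ (unzip s))) τ ∧ eqL (redW (proj₂ (unzip s))) u)
      (subseqs (zip σ w))

biAvoids : List (List ℕ × List ℕ) → List ℕ × List ℕ → Bool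
biAvoids Γ p = not (any (λ γ → biOccurs γ p) Γ)

AvBi : ℕ → List (List ℕ × List ℕ) → ℕ → ℕ
AvBi k Γ n = length (filter (λ p → Data.Bool.T? (biAvoids Γ p)) (wreath k n))

occurs : List ℕ → List ℕ → Bool
occurs τ σ = any (λ s → eqL (redP s) τ) (subseqs σ)

avoids : List (List ℕ) → List ℕ → Bool
avoids Υ σ = not (any (λ τ → occurs τ σ) Υ)

Av : List (List ℕ) → ℕ → ℕ
Av Υ n = length (filter (λ σ → Data.Bool.T? (avoids Υ σ)) (perms n))

Gamma : ℕ → List (List ℕ) → List (List ℕ × List ℕ)
Gamma j Υ = map (λ τ → τ , replicate j 0) Υ
            ++ ((1 ∷ 2 ∷ [] , 1 ∷ 0 ∷ []) ∷ (2 ∷ 1 ∷ [] , 1 ∷ 0 ∷ []) ∷ [])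

FPS : Set
FPS = ℕ → ℚ

sumℚ : List ℚ → ℚ
sumℚ = Data.List.foldr _+ℚ_ 0ℚ

_⊛_ : FPS → FPS → FPS
(f ⊛ g) n = sumℚ (map (λ i → f i *ℚ g (n ℕ.∸ i)) (upTo (suc n)))

oneS : FPS
oneS zero    = 1ℚ
oneS (suc _) = 0ℚ

_^S_ : FPS → ℕ → FPS
f ^S zero  = oneS
f ^S suc k = f ⊛ (f ^S k)

egf : (ℕ → ℕ) → FPS
egf a n = (+ a n) / (n !)
  where instance _ = n !≢0

-- Any two entries of a coloured permutation form the pattern 1-2 or 2-1, so bi-avoiding
-- (1-2, 1 0) and (2-1, 1 0) means that the colour word is weakly increasing: 0^i followed by
-- positive colours. Since the patterns of Υ₀ have constant colour, a Γ-avoider with colours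
-- 0, …, k is the same as a choice of the i-set of values carrying colour 0, a Υ-avoiding
-- pattern for those entries, and a Γ-avoider with colours 0, …, k - 1 (colours lowered by one)
-- for the remaining n - i entries; an occurrence meeting both blocks would need a colour 0
-- followed by a positive colour, which no pattern of Γ has. Hence
-- Av^Γ_{n,k+1} = Σ_i C(n,i) Av^Υ_i Av^Γ_{n-i,k}, a binomial convolution, i.e. a product of
-- exponential generating functions; with no colours only the empty object exists, and
-- induction on k gives the k-th power.

module Submission where

open import Defs

open import Data.Bool using (Bool; true; false; T; T?; not; _∧_)
open import Data.Bool.ListAction using (any)
open import Data.Bool.Properties using (T-∧)
open import Data.Empty using (⊥-elim)
open import Data.Integer using (+_)
import Data.Integer as ℤ
import Data.Integer.Properties as ℤ
open import Data.List
  using (List; []; _∷_; _++_; length; map; filter; concatMap; upTo; replicate; zip; unzip; take; drop; deduplicate)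
open import Data.List.Properties
  using (∷-injective; ++-identityʳ; length-++; length-++-sucʳ; length-map; length-replicate; length-upTo;
         length-take; length-drop; length-filter; map-id; map-id-local; map-∘; map-cong; map-cong-local;
         map-injective; map-replicate; map-applyUpTo; filter-none; filter-some; filter-notAll; filter-accept;
         filter-reject; zip-map; take++drop≡id)
open import Data.List.Membership.Propositional using (_∈_; _∉_; find; lose)
open import Data.List.Membership.Propositional.Properties
open import Data.List.Relation.Binary.Subset.Propositional using (_⊆_)
open import Data.List.Relation.Binary.Sublist.Propositional
  using ([]; _∷_; _∷ʳ_; from∈; lookup; ⊆-trans) renaming (_⊆_ to _⊑_)
import Data.List.Relation.Binary.Sublist.Propositional.Properties as Sublist
open import Data.List.Relation.Unary.All using (All; []; _∷_)
import Data.List.Relation.Unary.All as All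
import Data.List.Relation.Unary.All.Properties as All
open import Data.List.Relation.Unary.AllPairs using (AllPairs; []; _∷_)
import Data.List.Relation.Unary.AllPairs as AllPairs
import Data.List.Relation.Unary.AllPairs.Properties as AllPairs
open import Data.List.Relation.Unary.Any using (here; there; any?)
import Data.List.Relation.Unary.Any as Any
open import Data.List.Relation.Unary.Any.Properties using (any⁺; any⁻)
open import Data.List.Relation.Unary.Unique.Propositional using (Unique)
import Data.List.Relation.Unary.Unique.Propositional.Properties as Unique
open import Data.Nat as ℕ
  using (ℕ; zero; suc; pred; _+_; _*_; _∸_; _≤_; _<_; z≤n; s≤s; _≟_; _<?_; _⊓_; _!; NonZero)
open import Data.List.Membership.DecPropositional _≟_ using (_∈?_)
open import Data.Nat.Combinatorics using (_C_; nCk+nC[k+1]≡[n+1]C[k+1]; nCk≡n!/k![n-k]!; k![n∸k]!∣n!)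
open import Data.Nat.DivMod using (m/n*n≡m)
open import Data.Nat.ListAction using (sum)
open import Data.Nat.Properties
open import Data.Product using (Σ; _×_; _,_; proj₁; proj₂; map₁; map₂)
open import Data.Product.Properties using (,-injective)
open import Data.Rational using (_/_; toℚᵘ) renaming (_+_ to _+ℚ_; _*_ to _*ℚ_)
open import Data.Rational.Properties
  using (toℚᵘ-injective; toℚᵘ-homo-+; toℚᵘ-homo-*; toℚᵘ-fromℚᵘ; fromℚᵘ-cong; 0/n≡0)
import Data.Rational.Unnormalised as ℚᵘ
import Data.Rational.Unnormalised.Properties as ℚᵘ
open import Data.Sum using (_⊎_; inj₁; inj₂; [_,_]′)
open import Function using (_∘_; id)
open import Function.Bundles using (Equivalence)
open import Relation.Binary.Definitions using (DecidableEquality; tri<; tri≈; tri>)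
open import Relation.Binary.PropositionalEquality
open import Relation.Nullary using (¬_; Dec; yes; no; ¬?)
open import Relation.Nullary.Decidable using (toWitness; fromWitness)

module _ {A : Set} where

  ∈-++-∷⁻ : ∀ (as : List A) {bs x z} → z ∈ as ++ x ∷ bs → z ≢ x → z ∈ as ++ bs
  ∈-++-∷⁻ []       (here refl) z≢x = ⊥-elim (z≢x refl)
  ∈-++-∷⁻ []       (there z∈)  _   = z∈
  ∈-++-∷⁻ (a ∷ as) (here refl) _   = here refl
  ∈-++-∷⁻ (a ∷ as) (there z∈)  z≢x = there (∈-++-∷⁻ as z∈ z≢x)

  ∈-++-∷⁺ : ∀ (as : List A) {bs x z} → z ∈ as ++ bs → z ∈ as ++ x ∷ bs
  ∈-++-∷⁺ []       z∈          = there z∈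
  ∈-++-∷⁺ (a ∷ as) (here refl) = here refl
  ∈-++-∷⁺ (a ∷ as) (there z∈)  = there (∈-++-∷⁺ as z∈)

  Unique-++-∷⁻ : ∀ (as : List A) {y bs} → Unique (as ++ y ∷ bs) →
                 Unique (as ++ bs) × (∀ {z} → z ∈ as ++ bs → z ≢ y)
  Unique-++-∷⁻ []       (y∉ ∷ u) = u , λ z∈ z≡y → All.lookup y∉ z∈ (sym z≡y)
  Unique-++-∷⁻ (a ∷ as) {y} {bs} (a∉ ∷ u) with Unique-++-∷⁻ as u
  ... | u′ , ≢y = All.tabulate (λ z∈ → All.lookup a∉ (∈-++-∷⁺ as z∈)) ∷ u′ , ≢y′
    where
    ≢y′ : ∀ {z} → z ∈ a ∷ as ++ bs → z ≢ y
    ≢y′ (here refl) = All.lookup a∉ (∈-insert as)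
    ≢y′ (there z∈)  = ≢y z∈

  Unique-++⁻-disjoint : ∀ (xs : List A) {ys} → Unique (xs ++ ys) → ∀ {x} → x ∈ xs → All (x ≢_) ys
  Unique-++⁻-disjoint (a ∷ xs) (a∉ ∷ u) (here refl) = All.++⁻ʳ xs a∉
  Unique-++⁻-disjoint (a ∷ xs) (_ ∷ u)  (there x∈)  = Unique-++⁻-disjoint xs u x∈

  Unique-length-mono : ∀ {xs ys : List A} → Unique xs → xs ⊆ ys → length xs ≤ length ys
  Unique-length-mono {[]}     _        _  = z≤n
  Unique-length-mono {x ∷ xs} {ys} (x∉ ∷ u) xs⊆ys with ∈-∃++ (xs⊆ys (here refl))
  ... | as , bs , refl = subst (suc (length xs) ≤_) (sym (length-++-sucʳ as x bs))
    (s≤s (Unique-length-mono u λ z∈ →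
      ∈-++-∷⁻ as (xs⊆ys (there z∈)) λ z≡x → All.lookup x∉ z∈ (sym z≡x)))

  Unique-length-cong : ∀ {xs ys : List A} → Unique xs → Unique ys → xs ⊆ ys → ys ⊆ xs →
                       length xs ≡ length ys
  Unique-length-cong ux uy xs⊆ys ys⊆xs =
    ≤-antisym (Unique-length-mono ux xs⊆ys) (Unique-length-mono uy ys⊆xs)

  module _ (_≟ᴬ_ : DecidableEquality A) where

    Unique-⊆-length⇒⊇ : ∀ {xs ys : List A} → Unique xs → xs ⊆ ys → length ys ≤ length xs → ys ⊆ xs
    Unique-⊆-length⇒⊇ {xs} {ys} ux xs⊆ys ys≤xs {y} y∈ with any? (y ≟ᴬ_) xs
    ... | yes y∈xs = y∈xs
    ... | no  y∉xs with ∈-∃++ y∈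
    ... | as , bs , refl = ⊥-elim (<⇒≱ xs<ys ys≤xs)
      where
      xs<ys : length xs < length (as ++ y ∷ bs)
      xs<ys = subst (length xs <_) (sym (length-++-sucʳ as y bs))
        (s≤s (Unique-length-mono ux λ {z} z∈ →
          ∈-++-∷⁻ as (xs⊆ys z∈) λ z≡y → y∉xs (subst (_∈ xs) z≡y z∈)))

    ⊆-length⇒Unique : ∀ {xs ys : List A} → Unique xs → xs ⊆ ys → length ys ≤ length xs → Unique ys
    ⊆-length⇒Unique {xs} {[]}     _  _     _     = []
    ⊆-length⇒Unique {xs} {y ∷ ys} ux xs⊆ys ys≤xs with any? (y ≟ᴬ_) ys | any? (y ≟ᴬ_) xs
    ... | yes y∈ys | _ = ⊥-elim (<⇒≱ (s≤s (Unique-length-mono ux xs⊆ys′)) ys≤xs)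
      where
      xs⊆ys′ : xs ⊆ ys
      xs⊆ys′ z∈ with xs⊆ys z∈
      ... | here refl = y∈ys
      ... | there z∈ys = z∈ys
    ... | no y∉ys | no y∉xs = ⊥-elim (<⇒≱ (s≤s (Unique-length-mono ux xs⊆ys′)) ys≤xs)
      where
      xs⊆ys′ : xs ⊆ ys
      xs⊆ys′ z∈ with xs⊆ys z∈
      ... | here refl = ⊥-elim (y∉xs z∈)
      ... | there z∈ys = z∈ys
    ... | no y∉ys | yes y∈xs with ∈-∃++ y∈xs
    ... | as , bs , refl with Unique-++-∷⁻ as ux
    ... | u′ , ≢y = All.tabulate (λ z∈ y≡z → y∉ys (subst (_∈ ys) (sym y≡z) z∈))
                  ∷ ⊆-length⇒Unique u′ sub
                      (≤-pred (subst (suc (length ys) ≤_) (length-++-sucʳ as y bs) ys≤xs))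
      where
      sub : as ++ bs ⊆ ys
      sub z∈ with xs⊆ys (∈-++-∷⁺ as z∈)
      ... | here refl  = ⊥-elim (≢y z∈ refl)
      ... | there z∈ys = z∈ys

module _ {A B C : Set} where

  pairsWith : (A → B → C) → (A → List B) → List A → List C
  pairsWith h g = concatMap (λ a → map (h a) (g a))

  module _ {h : A → B → C} {g : A → List B} where

    ∈-pairsWith⁺ : ∀ {xs a b} → a ∈ xs → b ∈ g a → h a b ∈ pairsWith h g xs
    ∈-pairsWith⁺ {x ∷ xs} (here refl) b∈ = ∈-++⁺ˡ (∈-map⁺ (h x) b∈)
    ∈-pairsWith⁺ {x ∷ xs} (there a∈)  b∈ = ∈-++⁺ʳ (map (h x) (g x)) (∈-pairsWith⁺ a∈ b∈)

    ∈-pairsWith⁻ : ∀ {xs c} → c ∈ pairsWith h g xs → Σ A λ a → Σ B λ b → a ∈ xs × b ∈ g a × c ≡ h a b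
    ∈-pairsWith⁻ {x ∷ xs} c∈ with ∈-++⁻ (map (h x) (g x)) c∈
    ... | inj₁ c∈hx with ∈-map⁻ (h x) c∈hx
    ...   | b , b∈ , refl = x , b , here refl , b∈ , refl
    ∈-pairsWith⁻ {x ∷ xs} c∈ | inj₂ c∈rest with ∈-pairsWith⁻ c∈rest
    ...   | a , b , a∈ , b∈ , refl = a , b , there a∈ , b∈ , refl

    length-pairsWith : ∀ xs → length (pairsWith h g xs) ≡ sum (map (λ a → length (g a)) xs)
    length-pairsWith []       = refl
    length-pairsWith (x ∷ xs) = trans (length-++ (map (h x) (g x)))
      (cong₂ _+_ (length-map (h x) (g x)) (length-pairsWith xs))

    Unique-pairsWith : (∀ {a a′ b b′} → h a b ≡ h a′ b′ → a ≡ a′ × b ≡ b′) →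
                       ∀ {xs} → Unique xs → (∀ a → Unique (g a)) → Unique (pairsWith h g xs)
    Unique-pairsWith h-inj {[]}     _        _  = []
    Unique-pairsWith h-inj {x ∷ xs} (x∉ ∷ u) ug =
      Unique.++⁺ (Unique.map⁺ (λ eq → proj₂ (h-inj eq)) (ug x)) (Unique-pairsWith h-inj u ug) disjoint
      where
      disjoint : ∀ {c} → ¬ (c ∈ map (h x) (g x) × c ∈ pairsWith h g xs)
      disjoint (c∈hx , c∈rest) with ∈-map⁻ (h x) c∈hx | ∈-pairsWith⁻ c∈rest
      ... | _ , _ , refl | a , _ , a∈ , _ , eq = All.lookup x∉ a∈ (proj₁ (h-inj eq))

sum-map-const : ∀ {A : Set} (xs : List A) c → sum (map (λ _ → c) xs) ≡ length xs * c
sum-map-const []       c = refl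
sum-map-const (x ∷ xs) c = cong (_+_ c) (sum-map-const xs c)

module _ {A : Set} {P Q : A → Set} (P? : ∀ x → Dec (P x)) (Q? : ∀ x → Dec (Q x)) where

  filter-cong-on : ∀ xs → (∀ {y} → y ∈ xs → P y → Q y) → (∀ {y} → y ∈ xs → Q y → P y) →
                   filter P? xs ≡ filter Q? xs
  filter-cong-on []       _   _   = refl
  filter-cong-on (x ∷ xs) P⇒Q Q⇒P with P? x | Q? x
  ... | yes _  | yes _  = cong (x ∷_) (filter-cong-on xs (P⇒Q ∘ there) (Q⇒P ∘ there))
  ... | yes px | no ¬qx = ⊥-elim (¬qx (P⇒Q (here refl) px))
  ... | no ¬px | yes qx = ⊥-elim (¬px (Q⇒P (here refl) qx))
  ... | no _   | no _   = filter-cong-on xs (P⇒Q ∘ there) (Q⇒P ∘ there)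

  length-filter-mono-on : ∀ xs → (∀ {y} → y ∈ xs → P y → Q y) → length (filter P? xs) ≤ length (filter Q? xs)
  length-filter-mono-on []       _   = z≤n
  length-filter-mono-on (x ∷ xs) P⇒Q with P? x | Q? x
  ... | yes _  | yes _  = s≤s (length-filter-mono-on xs (P⇒Q ∘ there))
  ... | yes px | no ¬qx = ⊥-elim (¬qx (P⇒Q (here refl) px))
  ... | no _   | yes _  = m≤n⇒m≤1+n (length-filter-mono-on xs (P⇒Q ∘ there))
  ... | no _   | no _   = length-filter-mono-on xs (P⇒Q ∘ there)

  length-filter-<-on : ∀ xs → (∀ {y} → y ∈ xs → P y → Q y) → ∀ {w} → w ∈ xs → Q w → ¬ P w →
                       length (filter P? xs) < length (filter Q? xs)
  length-filter-<-on (x ∷ xs) P⇒Q (here refl) qw ¬pw with P? x | Q? x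
  ... | yes pw | _      = ⊥-elim (¬pw pw)
  ... | no _   | no ¬qw = ⊥-elim (¬qw qw)
  ... | no _   | yes _  = s≤s (length-filter-mono-on xs (P⇒Q ∘ there))
  length-filter-<-on (x ∷ xs) P⇒Q (there w∈) qw ¬pw with P? x | Q? x
  ... | yes _  | yes _  = s≤s (length-filter-<-on xs (P⇒Q ∘ there) w∈ qw ¬pw)
  ... | yes px | no ¬qx = ⊥-elim (¬qx (P⇒Q (here refl) px))
  ... | no _   | yes _  = m≤n⇒m≤1+n (length-filter-<-on xs (P⇒Q ∘ there) w∈ qw ¬pw)
  ... | no _   | no _   = length-filter-<-on xs (P⇒Q ∘ there) w∈ qw ¬pw

module _ {A : Set} {P : A → Set} (P? : ∀ x → Dec (P x)) where

  length-filter-cong-set : ∀ {xs ys} → Unique xs → Unique ys → xs ⊆ ys → ys ⊆ xs →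
                           length (filter P? xs) ≡ length (filter P? ys)
  length-filter-cong-set ux uy xs⊆ys ys⊆xs =
    Unique-length-cong (Unique.filter⁺ P? ux) (Unique.filter⁺ P? uy) (restrict xs⊆ys) (restrict ys⊆xs)
    where
    restrict : ∀ {xs ys} → xs ⊆ ys → filter P? xs ⊆ filter P? ys
    restrict sub z∈ = let z∈xs , pz = ∈-filter⁻ P? z∈ in ∈-filter⁺ P? (sub z∈xs) pz

  length-filter+length-filter-¬ : ∀ xs → length (filter P? xs) + length (filter (¬? ∘ P?) xs) ≡ length xs
  length-filter+length-filter-¬ []       = refl
  length-filter+length-filter-¬ (x ∷ xs) with P? x
  ... | yes _ = cong suc (length-filter+length-filter-¬ xs)
  ... | no  _ = trans (+-suc _ _) (cong suc (length-filter+length-filter-¬ xs))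

module _ {A B : Set} where

  filter-map : ∀ {P : B → Set} (P? : ∀ x → Dec (P x)) (f : A → B) xs →
               filter P? (map f xs) ≡ map f (filter (P? ∘ f) xs)
  filter-map P? f []       = refl
  filter-map P? f (x ∷ xs) with P? (f x)
  ... | yes _ = cong (f x ∷_) (filter-map P? f xs)
  ... | no  _ = filter-map P? f xs

  length-filter-map : ∀ {P : B → Set} (P? : ∀ x → Dec (P x)) (f : A → B) xs →
                      length (filter P? (map f xs)) ≡ length (filter (P? ∘ f) xs)
  length-filter-map P? f xs = trans (cong length (filter-map P? f xs)) (length-map f (filter (P? ∘ f) xs))

  Unique-map-on : ∀ (f : A → B) {xs} → Unique xs → (∀ {x y} → x ∈ xs → y ∈ xs → f x ≡ f y → x ≡ y) →
                  Unique (map f xs)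
  Unique-map-on f []       _   = []
  Unique-map-on f (x∉ ∷ u) inj =
    All.tabulate (λ z∈ fx≡z → let y , y∈ , z≡fy = ∈-map⁻ f z∈ in
                   All.lookup x∉ y∈ (inj (here refl) (there y∈) (trans fx≡z z≡fy)))
    ∷ Unique-map-on f u (λ x∈ y∈ → inj (there x∈) (there y∈))

module _ {A B : Set} {xs : List A} {ys : List B} (f : A → B) (g : B → A) where

  length-≡-inverses : Unique xs → Unique ys →
                      (∀ {x} → x ∈ xs → f x ∈ ys × g (f x) ≡ x) →
                      (∀ {y} → y ∈ ys → g y ∈ xs × f (g y) ≡ y) →
                      length xs ≡ length ys
  length-≡-inverses ux uy gf fg = begin
    length xs         ≡⟨ length-map f xs ⟨
    length (map f xs) ≡⟨ Unique-length-cong (Unique-map-on f ux f-injective) uy image⊆ys ys⊆image ⟩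
    length ys         ∎
    where
    open ≡-Reasoning
    f-injective : ∀ {x x′} → x ∈ xs → x′ ∈ xs → f x ≡ f x′ → x ≡ x′
    f-injective x∈ x′∈ fx≡fx′ = trans (sym (proj₂ (gf x∈))) (trans (cong g fx≡fx′) (proj₂ (gf x′∈)))
    image⊆ys : map f xs ⊆ ys
    image⊆ys y∈ with ∈-map⁻ f y∈
    ... | x , x∈ , refl = proj₁ (gf x∈)
    ys⊆image : ys ⊆ map f xs
    ys⊆image y∈ = subst (_∈ map f xs) (proj₂ (fg y∈)) (∈-map⁺ f (proj₁ (fg y∈)))

module _ {A : Set} where

  AllPairs-resp-⊒ : ∀ {R : A → A → Set} {s xs} → s ⊑ xs → AllPairs R xs → AllPairs R s
  AllPairs-resp-⊒ []         []         = []
  AllPairs-resp-⊒ (_ ∷ʳ s⊑)  (_ ∷ rxs)  = AllPairs-resp-⊒ s⊑ rxs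
  AllPairs-resp-⊒ (refl ∷ s⊑) (rx ∷ rxs) =
    All.tabulate (λ z∈ → All.lookup rx (lookup s⊑ z∈)) ∷ AllPairs-resp-⊒ s⊑ rxs

  ⊑-++⁻ : ∀ (xs : List A) {ys s} → s ⊑ xs ++ ys →
          Σ (List A) λ s₁ → Σ (List A) λ s₂ → s ≡ s₁ ++ s₂ × s₁ ⊑ xs × s₂ ⊑ ys
  ⊑-++⁻ []       s⊑ = [] , _ , refl , [] , s⊑
  ⊑-++⁻ (x ∷ xs) (.x ∷ʳ s⊑) with ⊑-++⁻ xs s⊑
  ... | s₁ , s₂ , refl , s₁⊑ , s₂⊑ = s₁ , s₂ , refl , x ∷ʳ s₁⊑ , s₂⊑
  ⊑-++⁻ (x ∷ xs) (refl ∷ s⊑) with ⊑-++⁻ xs s⊑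
  ... | s₁ , s₂ , refl , s₁⊑ , s₂⊑ = x ∷ s₁ , s₂ , refl , refl ∷ s₁⊑ , s₂⊑

  ∈-subseqs⁻ : ∀ {s xs : List A} → s ∈ subseqs xs → s ⊑ xs
  ∈-subseqs⁻ {xs = []}     (here refl) = []
  ∈-subseqs⁻ {xs = x ∷ xs} s∈ with ∈-++⁻ (map (x ∷_) (subseqs xs)) s∈
  ... | inj₁ s∈x∷ with ∈-map⁻ (x ∷_) s∈x∷
  ...   | t , t∈ , refl = refl ∷ ∈-subseqs⁻ t∈
  ∈-subseqs⁻ {xs = x ∷ xs} s∈ | inj₂ s∈rest = x ∷ʳ ∈-subseqs⁻ s∈rest

  ∈-subseqs⁺ : ∀ {s xs : List A} → s ⊑ xs → s ∈ subseqs xs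
  ∈-subseqs⁺ []                      = here refl
  ∈-subseqs⁺ (_∷ʳ_ {ys = xs} x s⊑) = ∈-++⁺ʳ (map (x ∷_) (subseqs xs)) (∈-subseqs⁺ s⊑)
  ∈-subseqs⁺ (refl ∷ s⊑)            = ∈-++⁺ˡ (∈-map⁺ (_ ∷_) (∈-subseqs⁺ s⊑))

module _ {A B : Set} (f : A → B) where

  ⊑-map⁻ : ∀ {t} (xs : List A) → t ⊑ map f xs → Σ (List A) λ s → s ⊑ xs × t ≡ map f s
  ⊑-map⁻ []       []          = [] , [] , refl
  ⊑-map⁻ (x ∷ xs) (_ ∷ʳ t⊑)   with ⊑-map⁻ xs t⊑
  ... | s , s⊑ , refl = s , x ∷ʳ s⊑ , refl
  ⊑-map⁻ (x ∷ xs) (refl ∷ t⊑) with ⊑-map⁻ xs t⊑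
  ... | s , s⊑ , refl = x ∷ s , refl ∷ s⊑ , refl

module _ {X : Set} where

  take-++ : ∀ (a b : List X) → take (length a) (a ++ b) ≡ a
  take-++ []      b = refl
  take-++ (x ∷ a) b = cong (x ∷_) (take-++ a b)

  drop-++ : ∀ (a b : List X) → drop (length a) (a ++ b) ≡ b
  drop-++ []      b = refl
  drop-++ (x ∷ a) b = drop-++ a b

module _ {X Y : Set} where

  zip-++ : ∀ (a b : List X) (c d : List Y) → length a ≡ length c → zip (a ++ b) (c ++ d) ≡ zip a c ++ zip b d
  zip-++ []      b []      d _   = refl
  zip-++ (x ∷ a) b (y ∷ c) d len = cong ((x , y) ∷_) (zip-++ a b c d (suc-injective len))

  map-proj₁-zip-⊑ : ∀ (σ : List X) (w : List Y) → map proj₁ (zip σ w) ⊑ σ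
  map-proj₁-zip-⊑ []      w       = []
  map-proj₁-zip-⊑ (x ∷ σ) []      = Sublist.[]⊆-universal (x ∷ σ)
  map-proj₁-zip-⊑ (x ∷ σ) (y ∷ w) = refl ∷ map-proj₁-zip-⊑ σ w

  ⊑-zip⁺ : ∀ {cs} (σ : List X) (w : List Y) → cs ⊑ w → length σ ≡ length w →
           Σ (List (X × Y)) λ s → s ⊑ zip σ w × map proj₂ s ≡ cs
  ⊑-zip⁺ []      []      []          _   = [] , [] , refl
  ⊑-zip⁺ (a ∷ σ) (x ∷ w) (_ ∷ʳ cs⊑)  len with ⊑-zip⁺ σ w cs⊑ (suc-injective len)
  ... | s , s⊑ , refl = s , (a , x) ∷ʳ s⊑ , refl
  ⊑-zip⁺ (a ∷ σ) (x ∷ w) (refl ∷ cs⊑) len with ⊑-zip⁺ σ w cs⊑ (suc-injective len)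
  ... | s , s⊑ , refl = (a , x) ∷ s , refl ∷ s⊑ , refl

  zip-map₁ : ∀ {X′ : Set} (f : X → X′) (σ : List X) (w : List Y) → zip (map f σ) w ≡ map (map₁ f) (zip σ w)
  zip-map₁ f σ w = trans (cong (zip (map f σ)) (sym (map-id w))) (zip-map f id σ w)

  zip-map₂ : ∀ {Y′ : Set} (g : Y → Y′) (σ : List X) (w : List Y) → zip σ (map g w) ≡ map (map₂ g) (zip σ w)
  zip-map₂ g σ w = trans (cong (λ σ′ → zip σ′ (map g w)) (sym (map-id σ))) (zip-map id g σ w)

oneTo : ℕ → List ℕ
oneTo n = map suc (upTo n)

oneTo-suc : ∀ n → oneTo (suc n) ≡ 1 ∷ map suc (oneTo n)
oneTo-suc n = cong (λ xs → 1 ∷ map suc xs) (sym (map-applyUpTo id suc n))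

∈-oneTo⁺ : ∀ {n x} → 1 ≤ x → x ≤ n → x ∈ oneTo n
∈-oneTo⁺ {x = suc x} (s≤s _) x≤n = ∈-map⁺ suc (∈-upTo⁺ x≤n)

∈-oneTo⁻ : ∀ {n x} → x ∈ oneTo n → 1 ≤ x × x ≤ n
∈-oneTo⁻ x∈ with ∈-map⁻ suc x∈
... | y , y∈ , refl = s≤s z≤n , ∈-upTo⁻ y∈

length-oneTo : ∀ n → length (oneTo n) ≡ n
length-oneTo n = trans (length-map suc (upTo n)) (length-upTo n)

oneTo-increasing : ∀ n → AllPairs _<_ (oneTo n)
oneTo-increasing n = AllPairs.map⁺ (AllPairs.applyUpTo⁺₁ id n (λ i<j _ → s≤s i<j))

increasing⇒Unique : ∀ {xs} → AllPairs _<_ xs → Unique xs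
increasing⇒Unique = AllPairs.map <⇒≢

Unique-oneTo : ∀ n → Unique (oneTo n)
Unique-oneTo n = increasing⇒Unique (oneTo-increasing n)

∈-words⁻ : ∀ {k n w} → w ∈ words k n → length w ≡ n × All (_< k) w
∈-words⁻ {n = zero}  (here refl) = refl , []
∈-words⁻ {k} {suc n} w∈ with ∈-pairsWith⁻ {h = _∷_} {g = λ _ → words k n} {xs = upTo k} w∈
... | a , w′ , a∈ , w′∈ , refl with ∈-words⁻ {n = n} w′∈
...   | refl , w′<k = refl , ∈-upTo⁻ a∈ ∷ w′<k

∈-words⁺ : ∀ {k n w} → length w ≡ n → All (_< k) w → w ∈ words k n
∈-words⁺ {w = []}    refl []         = here refl
∈-words⁺ {k} {w = a ∷ w} refl (a<k ∷ w<k) =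
  ∈-pairsWith⁺ {h = _∷_} {g = λ _ → words k (length w)} (∈-upTo⁺ a<k) (∈-words⁺ refl w<k)

Unique-words : ∀ k n → Unique (words k n)
Unique-words k zero    = [] ∷ []
Unique-words k (suc n) = Unique-pairsWith ∷-injective (Unique.upTo⁺ k) (λ _ → Unique-words k n)

record IsPerm (n : ℕ) (σ : List ℕ) : Set where
  field
    unique  : Unique σ
    length≡ : length σ ≡ n
    ⊆oneTo  : σ ⊆ oneTo n

  oneTo⊆ : oneTo n ⊆ σ
  oneTo⊆ = Unique-⊆-length⇒⊇ _≟_ unique ⊆oneTo (≤-reflexive (trans (length-oneTo n) (sym length≡)))

T-isPermᵇ⁻ : ∀ n σ → T (isPermᵇ n σ) → oneTo n ⊆ σ
T-isPermᵇ⁻ n σ t z∈ with ∈-map⁻ suc z∈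
... | i , i∈ , refl = toWitness (All.lookup (All.all⁺ _ (upTo n) t) i∈)

T-isPermᵇ⁺ : ∀ n σ → oneTo n ⊆ σ → T (isPermᵇ n σ)
T-isPermᵇ⁺ n σ oneTo⊆σ = All.all⁻ _ (All.tabulate λ i∈ → fromWitness (oneTo⊆σ (∈-map⁺ suc i∈)))

∈-perms⁻ : ∀ {n σ} → σ ∈ perms n → IsPerm n σ
∈-perms⁻ {n} σ∈ with ∈-filter⁻ (λ σ → T? (isPermᵇ n σ)) σ∈
... | σ∈sucs , t with ∈-map⁻ (map suc) σ∈sucs
...   | w , w∈ , refl with ∈-words⁻ w∈
...     | length-w , w<n = record
  { unique  = ⊆-length⇒Unique _≟_ (Unique-oneTo n) (T-isPermᵇ⁻ n _ t)
                (≤-reflexive (trans length-sucw (sym (length-oneTo n))))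
  ; length≡ = length-sucw
  ; ⊆oneTo  = λ z∈ → let y , y∈ , z≡ = ∈-map⁻ suc z∈ in
                subst (_∈ oneTo n) (sym z≡) (∈-map⁺ suc (∈-upTo⁺ (All.lookup w<n y∈)))
  }
  where
  length-sucw = trans (length-map suc w) length-w

∈-perms⁺ : ∀ {n σ} → IsPerm n σ → σ ∈ perms n
∈-perms⁺ {n} {σ} pm = ∈-filter⁺ (λ σ → T? (isPermᵇ n σ))
  (subst (_∈ map (map suc) (words n n)) (suc∘pred≡id σ ⊆oneTo)
    (∈-map⁺ (map suc) (∈-words⁺ (trans (length-map pred σ) length≡) (pred<n σ ⊆oneTo))))
  (T-isPermᵇ⁺ n σ oneTo⊆)
  where
  open IsPerm pm
  suc∘pred≡id : ∀ xs → xs ⊆ oneTo n → map suc (map pred xs) ≡ xs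
  suc∘pred≡id []       _   = refl
  suc∘pred≡id (x ∷ xs) sub with ∈-oneTo⁻ (sub (here refl))
  ... | s≤s _ , _ = cong (x ∷_) (suc∘pred≡id xs (sub ∘ there))
  pred<n : ∀ xs → xs ⊆ oneTo n → All (_< n) (map pred xs)
  pred<n []       _   = []
  pred<n (x ∷ xs) sub with ∈-oneTo⁻ (sub (here refl))
  ... | s≤s _ , x≤n = x≤n ∷ pred<n xs (sub ∘ there)

Unique-perms : ∀ n → Unique (perms n)
Unique-perms n = Unique.filter⁺ (λ σ → T? (isPermᵇ n σ))
  (Unique.map⁺ (map-injective suc-injective) (Unique-words n n))

∈-wreath⁻ : ∀ {k n σ w} → (σ , w) ∈ wreath k n → σ ∈ perms n × w ∈ words k n
∈-wreath⁻ {k} {n} σw∈ with ∈-pairsWith⁻ {h = _,_} {g = λ _ → words k n} {xs = perms n} σw∈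
... | _ , _ , σ∈ , w∈ , refl = σ∈ , w∈

∈-wreath⁺ : ∀ {k n σ w} → σ ∈ perms n → w ∈ words k n → (σ , w) ∈ wreath k n
∈-wreath⁺ {k} {n} = ∈-pairsWith⁺ {h = _,_} {g = λ _ → words k n}

Unique-wreath : ∀ k n → Unique (wreath k n)
Unique-wreath k n = Unique-pairsWith ,-injective (Unique-perms n) (λ _ → Unique-words k n)

-- Ranks, reduction and order-preserving relabelling

countBelow : ℕ → List ℕ → ℕ
countBelow x xs = length (filter (_<? x) xs)

rank : List ℕ → ℕ → ℕ
rank xs x = suc (countBelow x xs)

countBelow-zero : ∀ xs → countBelow 0 xs ≡ 0
countBelow-zero xs = cong length (filter-none (_<? 0) (All.tabulate {xs = xs} λ _ ()))

countBelow-suc-map-suc : ∀ x xs → countBelow (suc x) (map suc xs) ≡ countBelow x xs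
countBelow-suc-map-suc x xs = trans (length-filter-map (_<? suc x) suc xs)
  (cong length (filter-cong-on (λ y → suc y <? suc x) (_<? x) xs (λ _ → ≤-pred) (λ _ → s≤s)))

countBelow-oneTo : ∀ n x → countBelow x (oneTo n) ≡ pred x ⊓ n
countBelow-oneTo zero    x       = sym (⊓-zeroʳ (pred x))
countBelow-oneTo (suc n) zero    = countBelow-zero (oneTo (suc n))
countBelow-oneTo (suc n) (suc x) = trans (cong (countBelow (suc x)) (oneTo-suc n)) (step x)
  where
  step : ∀ x → countBelow (suc x) (1 ∷ map suc (oneTo n)) ≡ x ⊓ suc n
  step zero     = trans (countBelow-suc-map-suc 0 (oneTo n)) (countBelow-zero (oneTo n))
  step (suc x′) = cong suc (trans (countBelow-suc-map-suc (suc x′) (oneTo n)) (countBelow-oneTo n (suc x′)))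

countBelow<length : ∀ {x xs} → x ∈ xs → countBelow x xs < length xs
countBelow<length {x} {xs} x∈ =
  filter-notAll (_<? x) xs (Any.map (λ { refl → <-irrefl refl }) x∈)

countBelow-mono : ∀ xs {x y} → y ≤ x → countBelow y xs ≤ countBelow x xs
countBelow-mono xs y≤x = length-filter-mono-on (_<? _) (_<? _) xs (λ _ z<y → <-≤-trans z<y y≤x)

countBelow-mono-< : ∀ xs {x y} → x ∈ xs → x < y → countBelow x xs < countBelow y xs
countBelow-mono-< xs x∈ x<y =
  length-filter-<-on (_<? _) (_<? _) xs (λ _ z<x → <-trans z<x x<y) x∈ x<y (<-irrefl refl)

IsOrderEmbeddingOn : List ℕ → (ℕ → ℕ) → Set
IsOrderEmbeddingOn s f = ∀ {x y} → x ∈ s → y ∈ s → (x < y → f x < f y) × (f x < f y → x < y)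

rank-isOrderEmbeddingOn : ∀ xs → IsOrderEmbeddingOn xs (rank xs)
rank-isOrderEmbeddingOn xs x∈ y∈ =
  (λ x<y → s≤s (countBelow-mono-< xs x∈ x<y)) ,
  (λ rx<ry → ≰⇒> λ y≤x → <⇒≱ rx<ry (s≤s (countBelow-mono xs y≤x)))

IsOrderEmbeddingOn⇒injective : ∀ {s f} → IsOrderEmbeddingOn s f →
                               ∀ {x y} → x ∈ s → y ∈ s → f x ≡ f y → x ≡ y
IsOrderEmbeddingOn⇒injective emb {x} {y} x∈ y∈ fx≡fy with <-cmp x y
... | tri< x<y _ _ = ⊥-elim (<-irrefl fx≡fy (proj₁ (emb x∈ y∈) x<y))
... | tri≈ _ x≡y _ = x≡y
... | tri> _ _ y<x = ⊥-elim (<-irrefl (sym fx≡fy) (proj₁ (emb y∈ x∈) y<x))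

redP-map : ∀ {f s t} → IsOrderEmbeddingOn s f → t ⊆ s → redP (map f t) ≡ redP t
redP-map {f} {s} {t} emb t⊆s = trans (sym (map-∘ t)) (map-cong-local (All.tabulate λ x∈ → cong suc
  (trans (length-filter-map (_<? _) f t)
    (cong length (filter-cong-on (λ y → f y <? f _) (_<? _) t
      (λ y∈ → proj₂ (emb (t⊆s y∈) (t⊆s x∈))) (λ y∈ → proj₁ (emb (t⊆s y∈) (t⊆s x∈))))))))

redP-IsPerm : ∀ {n α} → IsPerm n α → redP α ≡ α
redP-IsPerm {n} {α} pm = map-id-local (All.tabulate λ {x} x∈ →
  let 1≤x , x≤n = ∈-oneTo⁻ (⊆oneTo x∈) in
  begin
    suc (countBelow x α)         ≡⟨ cong suc (length-filter-cong-set (_<? x) unique (Unique-oneTo n) ⊆oneTo oneTo⊆) ⟩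
    suc (countBelow x (oneTo n)) ≡⟨ cong suc (countBelow-oneTo n x) ⟩
    suc (pred x ⊓ n)             ≡⟨ cong suc (m≤n⇒m⊓n≡m (≤-trans pred[n]≤n x≤n)) ⟩
    suc (pred x)                 ≡⟨ suc-pred x {{ℕ.>-nonZero 1≤x}} ⟩
    x                            ∎)
  where open IsPerm pm; open ≡-Reasoning

IsPerm-redP : ∀ {p} → Unique p → IsPerm (length p) (redP p)
IsPerm-redP {p} u = record
  { unique  = Unique-map-on (rank p) u (IsOrderEmbeddingOn⇒injective (rank-isOrderEmbeddingOn p))
  ; length≡ = length-map (rank p) p
  ; ⊆oneTo  = λ z∈ → let x , x∈ , z≡ = ∈-map⁻ (rank p) z∈ in
                subst (_∈ oneTo (length p)) (sym z≡) (∈-oneTo⁺ (s≤s z≤n) (countBelow<length x∈))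
  }

nth : List ℕ → ℕ → ℕ
nth []       _       = 0
nth (a ∷ as) zero    = a
nth (a ∷ as) (suc r) = nth as r

nth-∈ : ∀ as {r} → r < length as → nth as r ∈ as
nth-∈ (a ∷ as) {zero}  _         = here refl
nth-∈ (a ∷ as) {suc r} (s≤s r<) = there (nth-∈ as r<)

nth-increasing : ∀ {as} → AllPairs _<_ as → ∀ {r s} → s < length as → r < s → nth as r < nth as s
nth-increasing {a ∷ as} (a< ∷ _)  {zero}  {suc s} (s≤s s<) _        = All.lookup a< (nth-∈ as s<)
nth-increasing {a ∷ as} (_ ∷ inc) {suc r} {suc s} (s≤s s<) (s≤s r<s) = nth-increasing inc s< r<s

nth-countBelow : ∀ {as} → AllPairs _<_ as → ∀ {x} → x ∈ as → nth as (countBelow x as) ≡ x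
nth-countBelow {a ∷ as} (a< ∷ _) (here refl) = cong (nth (a ∷ as)) (trans
  (cong length (filter-reject (_<? a) {xs = as} (<-irrefl refl)))
  (cong length (filter-none (_<? a) (All.map (λ a<y y<a → <-asym a<y y<a) a<))))
nth-countBelow {a ∷ as} (a< ∷ inc) {x} (there x∈) = trans
  (cong (nth (a ∷ as)) (cong length (filter-accept (_<? x) {xs = as} (All.lookup a< x∈))))
  (nth-countBelow inc x∈)

embed : List ℕ → ℕ → ℕ
embed as r = nth as (pred r)

map-embed-redP : ∀ {as q} → AllPairs _<_ as → Unique q → q ⊆ as → as ⊆ q → map (embed as) (redP q) ≡ q
map-embed-redP {as} {q} inc u q⊆as as⊆q = trans (sym (map-∘ q)) (map-id-local (All.tabulate λ {x} x∈ →
  trans (cong (nth as) (length-filter-cong-set (_<? x) u (increasing⇒Unique inc) q⊆as as⊆q))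
        (nth-countBelow inc (q⊆as x∈))))

module _ {as : List ℕ} (inc : AllPairs _<_ as) where

  embed-isOrderEmbeddingOn : IsOrderEmbeddingOn (oneTo (length as)) (embed as)
  embed-isOrderEmbeddingOn {x} {y} x∈ y∈ with ∈-oneTo⁻ x∈ | ∈-oneTo⁻ y∈
  ... | s≤s _ , x≤ | s≤s _ , y≤ = (λ { (s≤s x<y) → nth-increasing inc y≤ x<y }) , backwards
    where
    backwards : embed as x < embed as y → x < y
    backwards ex<ey with <-cmp x y
    ... | tri< x<y _ _ = x<y
    ... | tri≈ _ refl _ = ⊥-elim (<-irrefl refl ex<ey)
    ... | tri> _ _ (s≤s y<x) = ⊥-elim (<-asym ex<ey (nth-increasing inc x≤ y<x))

  embed-∈ : ∀ {r} → r ∈ oneTo (length as) → embed as r ∈ as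
  embed-∈ r∈ with ∈-oneTo⁻ r∈
  ... | s≤s _ , r≤ = nth-∈ as r≤

  module _ {α} (pm : IsPerm (length as) α) where
    open IsPerm pm

    map-embed⊆ : map (embed as) α ⊆ as
    map-embed⊆ z∈ with ∈-map⁻ (embed as) z∈
    ... | r , r∈ , refl = embed-∈ (⊆oneTo r∈)

    ⊆map-embed : as ⊆ map (embed as) α
    ⊆map-embed x∈ = subst (_∈ map (embed as) α) (nth-countBelow inc x∈)
      (∈-map⁺ (embed as) (oneTo⊆ (∈-oneTo⁺ (s≤s z≤n) (countBelow<length x∈))))

    Unique-map-embed : Unique (map (embed as) α)
    Unique-map-embed = Unique-map-on (embed as) unique
      (λ x∈ y∈ → IsOrderEmbeddingOn⇒injective embed-isOrderEmbeddingOn (⊆oneTo x∈) (⊆oneTo y∈))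

    redP-map-embed : redP (map (embed as) α) ≡ α
    redP-map-embed = trans (redP-map embed-isOrderEmbeddingOn ⊆oneTo) (redP-IsPerm pm)

module _ {A : Set} where

  sublistsOfLength : ℕ → List A → List (List A)
  sublistsOfLength zero    _        = [] ∷ []
  sublistsOfLength (suc i) []       = []
  sublistsOfLength (suc i) (x ∷ xs) = map (x ∷_) (sublistsOfLength i xs) ++ sublistsOfLength (suc i) xs

  ∈-sublistsOfLength⁻ : ∀ i xs {s} → s ∈ sublistsOfLength i xs → s ⊑ xs × length s ≡ i
  ∈-sublistsOfLength⁻ zero    xs       (here refl) = Sublist.[]⊆-universal xs , refl
  ∈-sublistsOfLength⁻ (suc i) (x ∷ xs) s∈ with ∈-++⁻ (map (x ∷_) (sublistsOfLength i xs)) s∈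
  ... | inj₁ s∈x∷ with ∈-map⁻ (x ∷_) s∈x∷
  ...   | t , t∈ , refl = let t⊑ , length-t = ∈-sublistsOfLength⁻ i xs t∈ in refl ∷ t⊑ , cong suc length-t
  ∈-sublistsOfLength⁻ (suc i) (x ∷ xs) s∈ | inj₂ s∈rest =
    let s⊑ , length-s = ∈-sublistsOfLength⁻ (suc i) xs s∈rest in x ∷ʳ s⊑ , length-s

  ∈-sublistsOfLength⁺ : ∀ {s xs} → s ⊑ xs → s ∈ sublistsOfLength (length s) xs
  ∈-sublistsOfLength⁺ {[]}    _           = here refl
  ∈-sublistsOfLength⁺ {a ∷ s} (x ∷ʳ s⊑)   =
    ∈-++⁺ʳ (map (x ∷_) (sublistsOfLength (length s) _)) (∈-sublistsOfLength⁺ s⊑)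
  ∈-sublistsOfLength⁺ {a ∷ s} (refl ∷ s⊑) = ∈-++⁺ˡ (∈-map⁺ (a ∷_) (∈-sublistsOfLength⁺ s⊑))

  Unique-sublistsOfLength : ∀ i {xs} → Unique xs → Unique (sublistsOfLength i xs)
  Unique-sublistsOfLength zero    _        = [] ∷ []
  Unique-sublistsOfLength (suc i) []       = []
  Unique-sublistsOfLength (suc i) {x ∷ xs} (x∉ ∷ u) =
    Unique.++⁺ (Unique.map⁺ (proj₂ ∘ ∷-injective) (Unique-sublistsOfLength i u))
               (Unique-sublistsOfLength (suc i) u) disjoint
    where
    disjoint : ∀ {s} → ¬ (s ∈ map (x ∷_) (sublistsOfLength i xs) × s ∈ sublistsOfLength (suc i) xs)
    disjoint (s∈x∷ , s∈rest) with ∈-map⁻ (x ∷_) s∈x∷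
    ... | _ , _ , refl = All.lookup x∉ (lookup (proj₁ (∈-sublistsOfLength⁻ (suc i) xs s∈rest)) (here refl)) refl

  length-sublistsOfLength : ∀ i xs → length (sublistsOfLength i xs) ≡ length xs C i
  length-sublistsOfLength zero    _        = refl
  length-sublistsOfLength (suc i) []       = refl
  length-sublistsOfLength (suc i) (x ∷ xs) = begin
    length (map (x ∷_) (sublistsOfLength i xs) ++ sublistsOfLength (suc i) xs)
      ≡⟨ length-++ (map (x ∷_) (sublistsOfLength i xs)) ⟩
    length (map (x ∷_) (sublistsOfLength i xs)) + length (sublistsOfLength (suc i) xs)
      ≡⟨ cong₂ _+_ (trans (length-map (λ (s : List A) → x ∷ s) (sublistsOfLength i xs))
                               (length-sublistsOfLength i xs))
                   (length-sublistsOfLength (suc i) xs) ⟩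
    length xs C i + length xs C suc i
      ≡⟨ nCk+nC[k+1]≡[n+1]C[k+1] (length xs) i ⟩
    suc (length xs) C suc i ∎
    where open ≡-Reasoning

filter-∈-⊑ : ∀ {s xs} → s ⊑ xs → Unique xs → filter (_∈? s) xs ≡ s
filter-∈-⊑ {s} []         _        = refl
filter-∈-⊑ {s} (x ∷ʳ s⊑)   (x∉ ∷ u) =
  trans (filter-reject (_∈? s) (λ x∈s → All.lookup x∉ (lookup s⊑ x∈s) refl)) (filter-∈-⊑ s⊑ u)
filter-∈-⊑ {x ∷ s} (refl ∷ s⊑) (x∉ ∷ u) =
  trans (filter-accept (_∈? x ∷ s) (here refl)) (cong (x ∷_) (trans
    (filter-cong-on (_∈? x ∷ s) (_∈? s) _
      (λ y∈ → λ { (here refl) → ⊥-elim (All.lookup x∉ y∈ refl) ; (there y∈s) → y∈s }) (λ _ → there))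
    (filter-∈-⊑ s⊑ u)))

complement : ℕ → List ℕ → List ℕ
complement n A = filter (¬? ∘ (_∈? A)) (oneTo n)

length-complement : ∀ {n A} → A ⊑ oneTo n → length (complement n A) ≡ n ∸ length A
length-complement {n} {A} A⊑ = begin
  length (complement n A)
    ≡⟨ m+n∸m≡n (length A) _ ⟨
  length A + length (complement n A) ∸ length A
    ≡⟨ cong (λ B → length B + length (complement n A) ∸ length A) (filter-∈-⊑ A⊑ (Unique-oneTo n)) ⟨
  length (filter (_∈? A) (oneTo n)) + length (complement n A) ∸ length A
    ≡⟨ cong (_∸ length A) (length-filter+length-filter-¬ (_∈? A) (oneTo n)) ⟩
  length (oneTo n) ∸ length A
    ≡⟨ cong (_∸ length A) (length-oneTo n) ⟩
  n ∸ length A ∎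
  where open ≡-Reasoning

∈-complement⁻ : ∀ n {A x} → x ∈ complement n A → x ∈ oneTo n × x ∉ A
∈-complement⁻ n {A} = ∈-filter⁻ (¬? ∘ (_∈? A)) {xs = oneTo n}

complement-increasing : ∀ n A → AllPairs _<_ (complement n A)
complement-increasing n A = AllPairs.filter⁺ (¬? ∘ (_∈? A)) (oneTo-increasing n)

T-not⁻ : ∀ {b} → T (not b) → ¬ T b
T-not⁻ {false} _ ()

T-not⁺ : ∀ {b} → ¬ T b → T (not b)
T-not⁺ {false} _  = _
T-not⁺ {true}  ¬t = ¬t _

T-any⁻ : ∀ {A : Set} (p : A → Bool) xs → T (any p xs) → Σ A λ x → x ∈ xs × T (p x)
T-any⁻ p xs t = find (any⁻ p xs t)

T-any⁺ : ∀ {A : Set} (p : A → Bool) {xs x} → x ∈ xs → T (p x) → T (any p xs)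
T-any⁺ p x∈ t = any⁺ p (lose x∈ t)

proj₁-unzip : ∀ {A B : Set} (s : List (A × B)) → proj₁ (unzip s) ≡ map proj₁ s
proj₁-unzip []      = refl
proj₁-unzip (x ∷ s) = cong (proj₁ x ∷_) (proj₁-unzip s)

proj₂-unzip : ∀ {A B : Set} (s : List (A × B)) → proj₂ (unzip s) ≡ map proj₂ s
proj₂-unzip []      = refl
proj₂-unzip (x ∷ s) = cong (proj₂ x ∷_) (proj₂-unzip s)

Occurs : List ℕ → List ℕ → Set
Occurs τ σ = Σ (List ℕ) λ s → s ⊑ σ × redP s ≡ τ

BiOccurs : List ℕ × List ℕ → List ℕ × List ℕ → Set
BiOccurs (τ , u) (σ , w) =
  Σ (List (ℕ × ℕ)) λ s → s ⊑ zip σ w × redP (map proj₁ s) ≡ τ × redW (map proj₂ s) ≡ u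

T-biOccurs⁻ : ∀ γ x → T (biOccurs γ x) → BiOccurs γ x
T-biOccurs⁻ (τ , u) (σ , w) t with T-any⁻ _ (subseqs (zip σ w)) t
... | s , s∈ , ts with Equivalence.to (T-∧ {eqL (redP (proj₁ (unzip s))) τ} {eqL (redW (proj₂ (unzip s))) u}) ts
...   | t₁ , t₂ = s , ∈-subseqs⁻ s∈ , trans (cong redP (sym (proj₁-unzip s))) (toWitness t₁)
                                    , trans (cong redW (sym (proj₂-unzip s))) (toWitness t₂)

T-biOccurs⁺ : ∀ γ x → BiOccurs γ x → T (biOccurs γ x)
T-biOccurs⁺ (τ , u) (σ , w) (s , s⊑ , redP≡ , redW≡) =
  T-any⁺ (λ s → eqL (redP (proj₁ (unzip s))) τ ∧ eqL (redW (proj₂ (unzip s))) u) (∈-subseqs⁺ s⊑)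
    (Equivalence.from (T-∧ {eqL (redP (proj₁ (unzip s))) τ} {eqL (redW (proj₂ (unzip s))) u})
      (fromWitness (trans (cong redP (proj₁-unzip s)) redP≡) , fromWitness (trans (cong redW (proj₂-unzip s)) redW≡)))

T-biAvoids⁻ : ∀ Γ x → T (biAvoids Γ x) → ∀ {γ} → γ ∈ Γ → ¬ BiOccurs γ x
T-biAvoids⁻ Γ x t γ∈ occ = T-not⁻ t (T-any⁺ (λ γ → biOccurs γ x) γ∈ (T-biOccurs⁺ _ x occ))

T-biAvoids⁺ : ∀ Γ x → (∀ {γ} → γ ∈ Γ → ¬ BiOccurs γ x) → T (biAvoids Γ x)
T-biAvoids⁺ Γ x avoid = T-not⁺ λ t →
  let γ , γ∈ , tγ = T-any⁻ (λ γ → biOccurs γ x) Γ t in avoid γ∈ (T-biOccurs⁻ γ x tγ)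

T-avoids⁻ : ∀ Υ σ → T (avoids Υ σ) → ∀ {τ} → τ ∈ Υ → ¬ Occurs τ σ
T-avoids⁻ Υ σ t τ∈ (s , s⊑ , redP≡) = T-not⁻ t
  (T-any⁺ (λ τ → occurs τ σ) τ∈ (T-any⁺ _ (∈-subseqs⁺ s⊑) (fromWitness redP≡)))

T-avoids⁺ : ∀ Υ σ → (∀ {τ} → τ ∈ Υ → ¬ Occurs τ σ) → T (avoids Υ σ)
T-avoids⁺ Υ σ avoid = T-not⁺ λ t →
  let τ , τ∈ , tτ = T-any⁻ (λ τ → occurs τ σ) Υ t
      s , s∈ , ts = T-any⁻ _ (subseqs σ) tτ
  in avoid τ∈ (s , ∈-subseqs⁻ s∈ , toWitness ts)

deduplicate-map : ∀ {f : ℕ → ℕ} → (∀ {x y} → f x ≡ f y → x ≡ y) →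
                  ∀ xs → deduplicate _≟_ (map f xs) ≡ map f (deduplicate _≟_ xs)
deduplicate-map {f} f-inj []       = refl
deduplicate-map {f} f-inj (x ∷ xs) = cong (f x ∷_) (begin
  filter (¬? ∘ (f x ≟_)) (deduplicate _≟_ (map f xs))
    ≡⟨ cong (filter (¬? ∘ (f x ≟_))) (deduplicate-map f-inj xs) ⟩
  filter (¬? ∘ (f x ≟_)) (map f (deduplicate _≟_ xs))
    ≡⟨ filter-map (¬? ∘ (f x ≟_)) f (deduplicate _≟_ xs) ⟩
  map f (filter (¬? ∘ (f x ≟_) ∘ f) (deduplicate _≟_ xs))
    ≡⟨ cong (map f) (filter-cong-on (¬? ∘ (f x ≟_) ∘ f) (¬? ∘ (x ≟_)) (deduplicate _≟_ xs)
                       (λ _ fx≢fy x≡y → fx≢fy (cong f x≡y)) (λ _ x≢y fx≡fy → x≢y (f-inj fx≡fy))) ⟩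
  map f (filter (¬? ∘ (x ≟_)) (deduplicate _≟_ xs)) ∎)
  where open ≡-Reasoning

redW-map-suc : ∀ w → redW (map suc w) ≡ redW w
redW-map-suc w = begin
  map (λ x → countBelow x (deduplicate _≟_ (map suc w))) (map suc w)
    ≡⟨ cong (λ D → map (λ x → countBelow x D) (map suc w)) (deduplicate-map suc-injective w) ⟩
  map (λ x → countBelow x (map suc (deduplicate _≟_ w))) (map suc w)
    ≡⟨ map-∘ w ⟨
  map (λ x → countBelow (suc x) (map suc (deduplicate _≟_ w))) w
    ≡⟨ map-cong (λ x → countBelow-suc-map-suc x (deduplicate _≟_ w)) w ⟩
  redW w ∎
  where open ≡-Reasoning

redW-replicate-0 : ∀ m → redW (replicate m 0) ≡ replicate m 0
redW-replicate-0 m =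
  trans (map-replicate _ m 0) (cong (replicate m) (countBelow-zero (deduplicate _≟_ (replicate m 0))))

redW≡0s⇒≮ : ∀ {w m} → redW w ≡ replicate m 0 → ∀ {c d} → c ∈ w → d ∈ w → ¬ c < d
redW≡0s⇒≮ {w} {m} redW≡ {c} {d} c∈ d∈ c<d = <-irrefl (sym rank-d≡0) 0<rank-d
  where
  rank-d≡0 : countBelow d (deduplicate _≟_ w) ≡ 0
  rank-d≡0 = All.lookup (All.map⁻ (subst (All (_≡ 0)) (sym redW≡) (All.replicate⁺ m refl))) d∈
  0<rank-d : 0 < countBelow d (deduplicate _≟_ w)
  0<rank-d = filter-some (_<? d) (lose (∈-deduplicate⁺ _≟_ c∈) c<d)

length-filter≡suc⇒∃ : ∀ {A : Set} {P : A → Set} (P? : ∀ x → Dec (P x)) xs {k} →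
                      length (filter P? xs) ≡ suc k → Σ A λ c → c ∈ xs × P c
length-filter≡suc⇒∃ P? (x ∷ xs) eq with P? x
... | yes px = x , here refl , px
... | no  _  = let c , c∈ , pc = length-filter≡suc⇒∃ P? xs eq in c , there c∈ , pc

redW-10⁻ : ∀ x y → redW (x ∷ y ∷ []) ≡ 1 ∷ 0 ∷ [] → y < x
redW-10⁻ x y redW≡
  with length-filter≡suc⇒∃ (_<? x) (deduplicate _≟_ (x ∷ y ∷ [])) (proj₁ (∷-injective redW≡))
... | c , c∈ , c<x with ∈-deduplicate⁻ _≟_ (x ∷ y ∷ []) c∈
...   | here refl         = ⊥-elim (<-irrefl refl c<x)
...   | there (here refl) = c<x

redW-10⁺ : ∀ x y → y < x → redW (x ∷ y ∷ []) ≡ 1 ∷ 0 ∷ []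
redW-10⁺ x y y<x = cong₂ _∷_ (cong length below-x) (cong₂ _∷_ (cong length below-y) refl)
  where
  dedup : deduplicate _≟_ (x ∷ y ∷ []) ≡ x ∷ y ∷ []
  dedup = cong (x ∷_) (filter-accept (¬? ∘ (x ≟_)) {xs = []} λ x≡y → <-irrefl (sym x≡y) y<x)
  below-x : filter (_<? x) (deduplicate _≟_ (x ∷ y ∷ [])) ≡ y ∷ []
  below-x = trans (cong (filter (_<? x)) dedup)
    (trans (filter-reject (_<? x) (<-irrefl refl)) (filter-accept (_<? x) {xs = []} y<x))
  below-y : filter (_<? y) (deduplicate _≟_ (x ∷ y ∷ [])) ≡ []
  below-y = trans (cong (filter (_<? y)) dedup)
    (trans (filter-reject (_<? y) (<-asym y<x)) (filter-reject (_<? y) {xs = []} (<-irrefl refl)))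

redP-pair : ∀ a b → a ≢ b → redP (a ∷ b ∷ []) ≡ 1 ∷ 2 ∷ [] ⊎ redP (a ∷ b ∷ []) ≡ 2 ∷ 1 ∷ []
redP-pair a b a≢b with <-cmp a b
... | tri< a<b _ _ = inj₁ (cong₂ _∷_
        (cong (suc ∘ length) (trans (filter-reject (_<? a) (<-irrefl refl)) (filter-reject (_<? a) {xs = []} (<-asym a<b))))
        (cong₂ _∷_ (cong (suc ∘ length) (trans (filter-accept (_<? b) a<b)
                                                (cong (a ∷_) (filter-reject (_<? b) {xs = []} (<-irrefl refl))))) refl))
... | tri≈ _ a≡b _ = ⊥-elim (a≢b a≡b)
... | tri> _ _ b<a = inj₂ (cong₂ _∷_
        (cong (suc ∘ length) (trans (filter-reject (_<? a) (<-irrefl refl)) (filter-accept (_<? a) {xs = []} b<a)))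
        (cong₂ _∷_ (cong (suc ∘ length) (trans (filter-reject (_<? b) (<-asym b<a))
                                                (filter-reject (_<? b) {xs = []} (<-irrefl refl)))) refl))

-- Splitting and gluing Γ-avoiders

colour0 : List ℕ → List (ℕ × ℕ)
colour0 = map (_, 0)

zip-replicate-0 : ∀ (σ : List ℕ) {m} → length σ ≡ m → zip σ (replicate m 0) ≡ colour0 σ
zip-replicate-0 []      refl = refl
zip-replicate-0 (a ∷ σ) refl = cong ((a , 0) ∷_) (zip-replicate-0 σ refl)

map-proj₁-colour0 : ∀ σ → map proj₁ (colour0 σ) ≡ σ
map-proj₁-colour0 σ = trans (sym (map-∘ σ)) (map-id σ)

map-proj₂-colour0 : ∀ σ → map proj₂ (colour0 σ) ≡ replicate (length σ) 0
map-proj₂-colour0 []      = refl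
map-proj₂-colour0 (a ∷ σ) = cong (0 ∷_) (map-proj₂-colour0 σ)

map-proj₂-map₂ : ∀ {A B C : Set} (g : B → C) (s : List (A × B)) →
                 map proj₂ (map (map₂ g) s) ≡ map g (map proj₂ s)
map-proj₂-map₂ g s = trans (sym (map-∘ s)) (map-∘ s)

leadingZeros : List ℕ → ℕ
leadingZeros []          = 0
leadingZeros (zero ∷ w)  = suc (leadingZeros w)
leadingZeros (suc _ ∷ w) = leadingZeros w

leadingZeros≤length : ∀ w → leadingZeros w ≤ length w
leadingZeros≤length []          = z≤n
leadingZeros≤length (zero ∷ w)  = s≤s (leadingZeros≤length w)
leadingZeros≤length (suc _ ∷ w) = m≤n⇒m≤1+n (leadingZeros≤length w)

leadingZeros-replicate-0-++-map-suc : ∀ i w → leadingZeros (replicate i 0 ++ map suc w) ≡ i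
leadingZeros-replicate-0-++-map-suc zero    []      = refl
leadingZeros-replicate-0-++-map-suc zero    (_ ∷ w) = leadingZeros-replicate-0-++-map-suc zero w
leadingZeros-replicate-0-++-map-suc (suc i) w       = cong suc (leadingZeros-replicate-0-++-map-suc i w)

positive-shape : ∀ w → All (0 <_) w → leadingZeros w ≡ 0 × map suc (map pred w) ≡ w
positive-shape []          []              = refl , refl
positive-shape (suc y ∷ w) (_ ∷ positive) =
  let no-zeros , sucpred = positive-shape w positive in no-zeros , cong (suc y ∷_) sucpred

WeaklyIncreasing : List ℕ → Set
WeaklyIncreasing w = ∀ {x y} → x ∷ y ∷ [] ⊑ w → ¬ y < x

WeaklyIncreasing-shape : ∀ w → WeaklyIncreasing w →
                         w ≡ replicate (leadingZeros w) 0 ++ map suc (map pred (drop (leadingZeros w) w))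
WeaklyIncreasing-shape []          _   = refl
WeaklyIncreasing-shape (zero ∷ w)  inc = cong (0 ∷_) (WeaklyIncreasing-shape w (inc ∘ (0 ∷ʳ_)))
WeaklyIncreasing-shape (suc c ∷ w) inc
  with positive-shape w (All.tabulate λ {y} y∈ → ≤-<-trans z≤n (≰⇒> (inc (refl ∷ from∈ y∈) ∘ s≤s)))
... | no-zeros , sucpred rewrite no-zeros = cong (suc c ∷_) (sym sucpred)

∈-Gamma⁻ : ∀ {j Υ γ} → γ ∈ Gamma j Υ →
           (Σ (List ℕ) λ τ → τ ∈ Υ × γ ≡ (τ , replicate j 0)) ⊎ proj₂ γ ≡ 1 ∷ 0 ∷ []
∈-Gamma⁻ {j} {Υ} γ∈ with ∈-++⁻ (map (_, replicate j 0) Υ) γ∈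
... | inj₁ γ∈Υ₀ = inj₁ (∈-map⁻ (_, replicate j 0) γ∈Υ₀)
... | inj₂ (here refl)         = inj₂ refl
... | inj₂ (there (here refl)) = inj₂ refl

Υ₀⊆Gamma : ∀ {j Υ τ} → τ ∈ Υ → (τ , replicate j 0) ∈ Gamma j Υ
Υ₀⊆Gamma {j} τ∈ = ∈-++⁺ˡ (∈-map⁺ (_, replicate j 0) τ∈)

12∈Gamma : ∀ {j Υ} → (1 ∷ 2 ∷ [] , 1 ∷ 0 ∷ []) ∈ Gamma j Υ
12∈Gamma {j} {Υ} = ∈-++⁺ʳ (map (_, replicate j 0) Υ) (here refl)

21∈Gamma : ∀ {j Υ} → (2 ∷ 1 ∷ [] , 1 ∷ 0 ∷ []) ∈ Gamma j Υ
21∈Gamma {j} {Υ} = ∈-++⁺ʳ (map (_, replicate j 0) Υ) (there (here refl))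

T-avoids-map : ∀ {Υ f s σ} → IsOrderEmbeddingOn s f → σ ⊆ s → T (avoids Υ σ) → T (avoids Υ (map f σ))
T-avoids-map {Υ} {f} {s} {σ} emb σ⊆s av = T-avoids⁺ Υ (map f σ) λ τ∈ (t , t⊑ , redP≡) →
  let t′ , t′⊑ , t≡ = ⊑-map⁻ f σ t⊑ in
  T-avoids⁻ Υ σ av τ∈ (t′ , t′⊑ ,
    trans (sym (redP-map emb (σ⊆s ∘ lookup t′⊑))) (trans (cong redP (sym t≡)) redP≡))

T-biAvoids-map : ∀ {Γ f s σ w} → IsOrderEmbeddingOn s f → σ ⊆ s → T (biAvoids Γ (σ , w)) →
                 T (biAvoids Γ (map f σ , w))
T-biAvoids-map {Γ} {f} {s} {σ} {w} emb σ⊆s ba =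
  T-biAvoids⁺ Γ (map f σ , w) λ γ∈ (t , t⊑ , redP≡ , redW≡) →
    let t′ , t′⊑ , t≡ = ⊑-map⁻ (map₁ f) (zip σ w) (subst (t ⊑_) (zip-map₁ f σ w) t⊑) in
    T-biAvoids⁻ Γ (σ , w) ba γ∈ (t′ , t′⊑ ,
      trans (sym (redP-map emb (σ⊆s ∘ lookup (⊆-trans (Sublist.map⁺ proj₁ t′⊑) (map-proj₁-zip-⊑ σ w)))))
        (trans (cong redP (trans (sym (map-∘ t′)) (map-∘ t′)))
               (trans (cong (redP ∘ map proj₁) (sym t≡)) redP≡)) ,
      trans (cong redW (map-∘ t′)) (trans (cong (redW ∘ map proj₂) (sym t≡)) redW≡))

BiOccurs-map-suc : ∀ {γ σ w} → BiOccurs γ (σ , w) → BiOccurs γ (σ , map suc w)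
BiOccurs-map-suc {σ = σ} {w} (s , s⊑ , redP≡ , redW≡) =
  map (map₂ suc) s , subst (map (map₂ suc) s ⊑_) (sym (zip-map₂ suc σ w)) (Sublist.map⁺ (map₂ suc) s⊑) ,
  trans (cong redP (sym (map-∘ s))) redP≡ ,
  trans (cong redW (map-proj₂-map₂ suc s)) (trans (redW-map-suc (map proj₂ s)) redW≡)

BiAvoids⇒WeaklyIncreasing : ∀ {j Υ σ w} → Unique σ → length σ ≡ length w → T (biAvoids (Gamma j Υ) (σ , w)) →
                            WeaklyIncreasing w
BiAvoids⇒WeaklyIncreasing {j} {Υ} {σ} {w} u len ba {x} {y} xy⊑ y<x with ⊑-zip⁺ σ w xy⊑ len
... | (a , x) ∷ (b , y) ∷ [] , s⊑ , refl = [ occurrence 12∈Gamma , occurrence 21∈Gamma ]′ (redP-pair a b a≢b)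
  where
  a≢b : a ≢ b
  a≢b = All.lookup (AllPairs.head (AllPairs-resp-⊒ (⊆-trans (Sublist.map⁺ proj₁ s⊑) (map-proj₁-zip-⊑ σ w)) u))
                   (here refl)
  occurrence : ∀ {τ} → (τ , 1 ∷ 0 ∷ []) ∈ Gamma j Υ → redP (a ∷ b ∷ []) ≢ τ
  occurrence τ∈ redP≡ = T-biAvoids⁻ _ (σ , w) ba τ∈ (_ , s⊑ , redP≡ , redW-10⁺ x y y<x)

BiOccurs-map-suc⁻ : ∀ {γ σ w} → BiOccurs γ (σ , map suc w) → BiOccurs γ (σ , w)
BiOccurs-map-suc⁻ {σ = σ} {w} (s , s⊑ , redP≡ , redW≡)
  with ⊑-map⁻ (map₂ suc) (zip σ w) (subst (s ⊑_) (zip-map₂ suc σ w) s⊑)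
... | s′ , s′⊑ , refl = s′ , s′⊑ , trans (cong redP (map-∘ s′)) redP≡ ,
  trans (sym (redW-map-suc (map proj₂ s′))) (trans (cong redW (sym (map-proj₂-map₂ suc s′))) redW≡)

redW-0∷≢10 : ∀ w → redW (0 ∷ w) ≢ 1 ∷ 0 ∷ []
redW-0∷≢10 []          ()
redW-0∷≢10 (c ∷ [])    redW≡ = n≮0 (redW-10⁻ 0 c redW≡)
redW-0∷≢10 (c ∷ d ∷ w) ()

module _ {j : ℕ} {Υ : List (List ℕ)} where

  -- An occurrence meeting both blocks has a colour 0 before a positive colour, which neither
  -- the constant colour words of Υ₀ nor the colour word 1 0 allow.
  biAvoids-++ : ∀ P S w′ → T (avoids Υ P) → T (biAvoids (Gamma j Υ) (S , w′)) →
                T (biAvoids (Gamma j Υ) (P ++ S , replicate (length P) 0 ++ map suc w′))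
  biAvoids-++ P S w′ av ba = T-biAvoids⁺ (Gamma j Υ) _ λ γ∈ occ → no-occurrence γ∈ occ
    where
    zip≡ : zip (P ++ S) (replicate (length P) 0 ++ map suc w′) ≡ colour0 P ++ zip S (map suc w′)
    zip≡ = trans (zip-++ P S _ _ (sym (length-replicate (length P)))) (cong (_++ _) (zip-replicate-0 P refl))

    no-occurrence : ∀ {γ} → γ ∈ Gamma j Υ → ¬ BiOccurs γ (P ++ S , replicate (length P) 0 ++ map suc w′)
    no-occurrence {τ , u} γ∈ (s , s⊑ , redP≡ , redW≡) with ⊑-++⁻ (colour0 P) (subst (s ⊑_) zip≡ s⊑)
    ... | s₁ , s₂ , refl , s₁⊑ , s₂⊑ with ⊑-map⁻ (_, 0) P s₁⊑
    ... | [] , _ , refl =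
          T-biAvoids⁻ _ (S , w′) ba γ∈ (BiOccurs-map-suc⁻ (s₂ , s₂⊑ , redP≡ , redW≡))
    ... | a ∷ t , t⊑ , refl with ∈-Gamma⁻ γ∈
    ...   | inj₂ refl = redW-0∷≢10 _ redW≡
    ...   | inj₁ (τ′ , τ∈ , refl) with s₂
    ...     | [] = T-avoids⁻ Υ P av τ∈ (a ∷ t , t⊑ ,
                     trans (cong redP (sym (trans (cong (map proj₁) (++-identityʳ (colour0 (a ∷ t))))
                                                  (map-proj₁-colour0 (a ∷ t))))) redP≡)
    ...     | (b , c) ∷ s₂′ = redW≡0s⇒≮ redW≡ (here refl) c∈ 0<c
      where
      c∈ : c ∈ map proj₂ (colour0 (a ∷ t) ++ (b , c) ∷ s₂′)
      c∈ = ∈-map⁺ proj₂ (∈-++⁺ʳ (colour0 (a ∷ t)) (here refl))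
      0<c : 0 < c
      0<c with ∈-map⁻ (map₂ suc) (subst ((b , c) ∈_) (zip-map₂ suc S w′) (lookup s₂⊑ (here refl)))
      ... | _ , _ , refl = s≤s z≤n

module BiAvoidsSplit {j : ℕ} {Υ : List (List ℕ)} (Υ⊆Sⱼ : All (_∈ perms j) Υ) {σ w : List ℕ}
                     (u : Unique σ) (len : length σ ≡ length w) (ba : T (biAvoids (Gamma j Υ) (σ , w))) where

  i : ℕ
  i = leadingZeros w

  w′ : List ℕ
  w′ = map pred (drop i w)

  colours≡ : w ≡ replicate i 0 ++ map suc w′
  colours≡ = WeaklyIncreasing-shape w (BiAvoids⇒WeaklyIncreasing {j} {Υ} u len ba)

  length-take-i : length (take i σ) ≡ i
  length-take-i = trans (length-take i σ) (m≤n⇒m⊓n≡m (subst (i ≤_) (sym len) (leadingZeros≤length w)))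

  zip≡ : zip σ w ≡ colour0 (take i σ) ++ zip (drop i σ) (map suc w′)
  zip≡ = begin
    zip σ w
      ≡⟨ cong₂ zip (sym (take++drop≡id i σ)) colours≡ ⟩
    zip (take i σ ++ drop i σ) (replicate i 0 ++ map suc w′)
      ≡⟨ zip-++ (take i σ) (drop i σ) (replicate i 0) (map suc w′) (trans length-take-i (sym (length-replicate i))) ⟩
    zip (take i σ) (replicate i 0) ++ zip (drop i σ) (map suc w′)
      ≡⟨ cong (_++ zip (drop i σ) (map suc w′)) (zip-replicate-0 (take i σ) length-take-i) ⟩
    colour0 (take i σ) ++ zip (drop i σ) (map suc w′) ∎
    where open ≡-Reasoning

  avoids-take : T (avoids Υ (take i σ))
  avoids-take = T-avoids⁺ Υ (take i σ) no-occurrence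
    where
    no-occurrence : ∀ {τ} → τ ∈ Υ → ¬ Occurs τ (take i σ)
    no-occurrence {τ} τ∈ (t , t⊑ , redP≡) = T-biAvoids⁻ (Gamma j Υ) (σ , w) ba (Υ₀⊆Gamma τ∈)
      (colour0 t ,
       subst (colour0 t ⊑_) (sym zip≡) (Sublist.++⁺ʳ _ (Sublist.map⁺ (_, 0) t⊑)) ,
       trans (cong redP (map-proj₁-colour0 t)) redP≡ ,
       (begin
         redW (map proj₂ (colour0 t))  ≡⟨ cong redW (map-proj₂-colour0 t) ⟩
         redW (replicate (length t) 0) ≡⟨ redW-replicate-0 (length t) ⟩
         replicate (length t) 0        ≡⟨ cong (λ m → replicate m 0) length-t ⟩
         replicate j 0                 ∎))
      where
      open ≡-Reasoning
      length-t : length t ≡ j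
      length-t = trans (sym (length-map (rank t) t))
                   (trans (cong length redP≡) (IsPerm.length≡ (∈-perms⁻ (All.lookup Υ⊆Sⱼ τ∈))))

  biAvoids-drop : T (biAvoids (Gamma j Υ) (drop i σ , w′))
  biAvoids-drop = T-biAvoids⁺ (Gamma j Υ) (drop i σ , w′) λ γ∈ occ →
    let s , s⊑ , redP≡ , redW≡ = BiOccurs-map-suc occ in
    T-biAvoids⁻ (Gamma j Υ) (σ , w) ba γ∈
      (s , subst (s ⊑_) (sym zip≡) (Sublist.++⁺ˡ (colour0 (take i σ)) s⊑) , redP≡ , redW≡)

-- Exponential generating functions

nCk*[k!*[n∸k]!]≡n! : ∀ {n k} → k ≤ n → (n C k) * (k ! * (n ∸ k) !) ≡ n !
nCk*[k!*[n∸k]!]≡n! {n} {k} k≤n =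
  trans (cong (_* (k ! * (n ∸ k) !)) (nCk≡n!/k![n-k]! k≤n)) (m/n*n≡m (k![n∸k]!∣n! k≤n))
  where instance _ = k !* (n ∸ k) !≢0

toℚᵘ-/ : ∀ a d → toℚᵘ (+ a / suc d) ℚᵘ.≃ ℚᵘ.mkℚᵘ (+ a) d
toℚᵘ-/ a d = toℚᵘ-fromℚᵘ (ℚᵘ.mkℚᵘ (+ a) d)

/-cross : ∀ a b d e .{{_ : NonZero d}} .{{_ : NonZero e}} → a * e ≡ b * d → + a / d ≡ + b / e
/-cross a b (suc d) (suc e) ae≡bd = fromℚᵘ-cong {ℚᵘ.mkℚᵘ (+ a) d} {ℚᵘ.mkℚᵘ (+ b) e}
  (ℚᵘ.*≡* (trans (sym (ℤ.pos-* a (suc e))) (trans (cong +_ ae≡bd) (ℤ.pos-* b (suc d)))))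

/-*-/ : ∀ a b d e .{{_ : NonZero d}} .{{_ : NonZero e}} →
        (+ a / d) *ℚ (+ b / e) ≡ (+ (a * b) / (d * e)) {{m*n≢0 d e}}
/-*-/ a b (suc d) (suc e) = toℚᵘ-injective (begin
  toℚᵘ ((+ a / suc d) *ℚ (+ b / suc e))              ≈⟨ toℚᵘ-homo-* (+ a / suc d) (+ b / suc e) ⟩
  toℚᵘ (+ a / suc d) ℚᵘ.* toℚᵘ (+ b / suc e)        ≈⟨ ℚᵘ.*-cong (toℚᵘ-/ a d) (toℚᵘ-/ b e) ⟩
  ℚᵘ.mkℚᵘ (+ a ℤ.* + b) (e + d * suc e)              ≈⟨ ℚᵘ.*≡* (cong (ℤ._* + suc (e + d * suc e)) (sym (ℤ.pos-* a b))) ⟩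
  ℚᵘ.mkℚᵘ (+ (a * b)) (e + d * suc e)                ≈⟨ toℚᵘ-/ (a * b) (e + d * suc e) ⟨
  toℚᵘ (+ (a * b) / (suc d * suc e))                 ∎)
  where open ℚᵘ.≃-Reasoning

/-+-/ : ∀ a b d .{{_ : NonZero d}} → (+ a / d) +ℚ (+ b / d) ≡ + (a + b) / d
/-+-/ a b (suc d) = toℚᵘ-injective (let open ℚᵘ.≃-Reasoning in begin
  toℚᵘ ((+ a / suc d) +ℚ (+ b / suc d))       ≈⟨ toℚᵘ-homo-+ (+ a / suc d) (+ b / suc d) ⟩
  toℚᵘ (+ a / suc d) ℚᵘ.+ toℚᵘ (+ b / suc d)  ≈⟨ ℚᵘ.+-cong (toℚᵘ-/ a d) (toℚᵘ-/ b d) ⟩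
  ℚᵘ.mkℚᵘ (+ a) d ℚᵘ.+ ℚᵘ.mkℚᵘ (+ b) d        ≈⟨ ℚᵘ.*≡* cross ⟩
  ℚᵘ.mkℚᵘ (+ (a + b)) d                        ≈⟨ toℚᵘ-/ (a + b) d ⟨
  toℚᵘ (+ (a + b) / suc d)                     ∎)
  where
  D = suc d
  cross : (+ a ℤ.* + D ℤ.+ + b ℤ.* + D) ℤ.* + D ≡ + (a + b) ℤ.* + (D * D)
  cross = begin
    (+ a ℤ.* + D ℤ.+ + b ℤ.* + D) ℤ.* + D ≡⟨ cong (ℤ._* + D) (cong₂ ℤ._+_ (ℤ.pos-* a D) (ℤ.pos-* b D)) ⟨
    (+ (a * D) ℤ.+ + (b * D)) ℤ.* + D     ≡⟨ cong (ℤ._* + D) (ℤ.pos-+ (a * D) (b * D)) ⟨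
    + (a * D + b * D) ℤ.* + D             ≡⟨ ℤ.pos-* (a * D + b * D) D ⟨
    + ((a * D + b * D) * D)               ≡⟨ cong +_ (trans (cong (_* D) (sym (*-distribʳ-+ D a b))) (*-assoc (a + b) D D)) ⟩
    + ((a + b) * (D * D))                 ≡⟨ ℤ.pos-* (a + b) (D * D) ⟩
    + (a + b) ℤ.* + (D * D)               ∎
    where open ≡-Reasoning

sumℚ-map-/ : ∀ {A : Set} (c : A → ℕ) xs D .{{_ : NonZero D}} →
             sumℚ (map (λ x → + c x / D) xs) ≡ + sum (map c xs) / D
sumℚ-map-/ c []       D = sym (0/n≡0 D)
sumℚ-map-/ c (x ∷ xs) D = trans (cong (+ c x / D +ℚ_) (sumℚ-map-/ c xs D)) (/-+-/ (c x) (sum (map c xs)) D)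

⊛-congʳ : ∀ f {g h} → (∀ n → g n ≡ h n) → ∀ n → (f ⊛ g) n ≡ (f ⊛ h) n
⊛-congʳ f g≗h n = cong sumℚ (map-cong (λ i → cong (f i *ℚ_) (g≗h (n ∸ i))) (upTo (suc n)))

egf-binomial-term : ∀ (f g : ℕ → ℕ) {n i} → i ≤ n →
                    (+ ((n C i) * (f i * g (n ∸ i))) / n !) {{n !≢0}} ≡ egf f i *ℚ egf g (n ∸ i)
egf-binomial-term f g {n} {i} i≤n = sym (trans
  (/-*-/ (f i) (g (n ∸ i)) (i !) ((n ∸ i) !) {{i !≢0}} {{(n ∸ i) !≢0}})
  (/-cross (f i * g (n ∸ i)) ((n C i) * (f i * g (n ∸ i))) (i ! * (n ∸ i) !) (n !)
           {{m*n≢0 (i !) ((n ∸ i) !) {{i !≢0}} {{(n ∸ i) !≢0}}}} {{n !≢0}} (begin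
    f i * g (n ∸ i) * n !                            ≡⟨ cong (f i * g (n ∸ i) *_) (nCk*[k!*[n∸k]!]≡n! i≤n) ⟨
    f i * g (n ∸ i) * ((n C i) * (i ! * (n ∸ i) !))  ≡⟨ *-assoc (f i * g (n ∸ i)) (n C i) _ ⟨
    f i * g (n ∸ i) * (n C i) * (i ! * (n ∸ i) !)    ≡⟨ cong (_* (i ! * (n ∸ i) !)) (*-comm (f i * g (n ∸ i)) (n C i)) ⟩
    (n C i) * (f i * g (n ∸ i)) * (i ! * (n ∸ i) !)  ∎)))
  where open ≡-Reasoning

egf-binomial-convolution : ∀ (f g h : ℕ → ℕ) {n} →
                           h n ≡ sum (map (λ i → (n C i) * (f i * g (n ∸ i))) (upTo (suc n))) →
                           egf h n ≡ (egf f ⊛ egf g) n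
egf-binomial-convolution f g h {n} h≡ = begin
  (+ h n / n !) {{n !≢0}}
    ≡⟨ cong (λ m → (+ m / n !) {{n !≢0}}) h≡ ⟩
  (+ sum (map (λ i → (n C i) * (f i * g (n ∸ i))) (upTo (suc n))) / n !) {{n !≢0}}
    ≡⟨ sumℚ-map-/ (λ i → (n C i) * (f i * g (n ∸ i))) (upTo (suc n)) (n !) {{n !≢0}} ⟨
  sumℚ (map (λ i → (+ ((n C i) * (f i * g (n ∸ i))) / n !) {{n !≢0}}) (upTo (suc n)))
    ≡⟨ cong sumℚ (map-cong-local {xs = upTo (suc n)}
                   (All.tabulate λ i∈ → egf-binomial-term f g {n} (≤-pred (∈-upTo⁻ i∈)))) ⟩
  (egf f ⊛ egf g) n ∎
  where open ≡-Reasoning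

-- Counting Γ-avoiders by their colour-0 block

module Decomposition {j : ℕ} {Υ : List (List ℕ)} (Υ⊆Sⱼ : All (_∈ perms j) Υ) where

  Γ : List (List ℕ × List ℕ)
  Γ = Gamma j Υ

  Avoider : List ℕ → Set
  Avoider σ = T (avoids Υ σ)

  BiAvoider : List ℕ × List ℕ → Set
  BiAvoider p = T (biAvoids Γ p)

  avoiders : ℕ → List (List ℕ)
  avoiders i = filter (T? ∘ avoids Υ) (perms i)

  biAvoiders : ℕ → ℕ → List (List ℕ × List ℕ)
  biAvoiders k n = filter (T? ∘ biAvoids Γ) (wreath k n)

  -- (i , A , α , β , w′): the i entries of colour 0 take the values A in the pattern α; the
  -- others form the pattern β, with colours w′ lowered by one.
  Piece : Set
  Piece = ℕ × List ℕ × List ℕ × (List ℕ × List ℕ)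

  piecesOfSize : ℕ → ℕ → ℕ → List (List ℕ × List ℕ × (List ℕ × List ℕ))
  piecesOfSize k n i = pairsWith _,_ (λ _ → pairsWith _,_ (λ _ → biAvoiders k (n ∸ i)) (avoiders i))
                                     (sublistsOfLength i (oneTo n))

  pieces : ℕ → ℕ → List Piece
  pieces k n = pairsWith _,_ (piecesOfSize k n) (upTo (suc n))

  module _ {k n : ℕ} where

    ∈-pieces⁻ : ∀ {i A α β w′} → (i , A , α , β , w′) ∈ pieces k n →
                i ∈ upTo (suc n) × A ∈ sublistsOfLength i (oneTo n) × α ∈ avoiders i ×
                (β , w′) ∈ biAvoiders k (n ∸ i)
    ∈-pieces⁻ p∈ with ∈-pairsWith⁻ {h = _,_} {g = piecesOfSize k n} {xs = upTo (suc n)} p∈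
    ... | i , _ , i∈ , p∈i , refl with ∈-pairsWith⁻ {h = _,_} {xs = sublistsOfLength i (oneTo n)} p∈i
    ...   | A , _ , A∈ , p∈A , refl
      with ∈-pairsWith⁻ {h = _,_} {g = λ _ → biAvoiders k (n ∸ i)} {xs = avoiders i} p∈A
    ...     | α , _ , α∈ , βw∈ , refl = i∈ , A∈ , α∈ , βw∈

    ∈-pieces⁺ : ∀ {i A α β w′} → i ∈ upTo (suc n) → A ∈ sublistsOfLength i (oneTo n) → α ∈ avoiders i →
                (β , w′) ∈ biAvoiders k (n ∸ i) → (i , A , α , β , w′) ∈ pieces k n
    ∈-pieces⁺ {i} i∈ A∈ α∈ βw∈ = ∈-pairsWith⁺ {h = _,_} {g = piecesOfSize k n} i∈
      (∈-pairsWith⁺ {h = _,_} A∈ (∈-pairsWith⁺ {h = _,_} {g = λ _ → biAvoiders k (n ∸ i)} α∈ βw∈))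

  Unique-pieces : ∀ k n → Unique (pieces k n)
  Unique-pieces k n = Unique-pairsWith ,-injective (Unique.upTo⁺ (suc n)) λ i →
    Unique-pairsWith ,-injective (Unique-sublistsOfLength i (Unique-oneTo n)) λ _ →
      Unique-pairsWith ,-injective (Unique.filter⁺ _ (Unique-perms i)) λ _ →
        Unique.filter⁺ _ (Unique-wreath k (n ∸ i))

  length-piecesOfSize : ∀ k n i → length (piecesOfSize k n i) ≡ (n C i) * (Av Υ i * AvBi k Γ (n ∸ i))
  length-piecesOfSize k n i = begin
    length (piecesOfSize k n i)
      ≡⟨ length-pairsWith {h = _,_} {g = λ _ → parts} (sublistsOfLength i (oneTo n)) ⟩
    sum (map (λ _ → length parts) (sublistsOfLength i (oneTo n)))
      ≡⟨ sum-map-const (sublistsOfLength i (oneTo n)) (length parts) ⟩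
    length (sublistsOfLength i (oneTo n)) * length parts
      ≡⟨ cong₂ _*_ (trans (length-sublistsOfLength i (oneTo n)) (cong (_C i) (length-oneTo n)))
                   (trans (length-pairsWith {h = _,_} {g = λ _ → biAvoiders k (n ∸ i)} (avoiders i))
                          (sum-map-const (avoiders i) (AvBi k Γ (n ∸ i)))) ⟩
    (n C i) * (Av Υ i * AvBi k Γ (n ∸ i)) ∎
    where
    open ≡-Reasoning
    parts = pairsWith _,_ (λ _ → biAvoiders k (n ∸ i)) (avoiders i)

  length-pieces : ∀ k n →
                  length (pieces k n) ≡ sum (map (λ i → (n C i) * (Av Υ i * AvBi k Γ (n ∸ i))) (upTo (suc n)))
  length-pieces k n = trans (length-pairsWith {h = _,_} {g = piecesOfSize k n} (upTo (suc n)))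
                            (cong sum (map-cong (length-piecesOfSize k n) (upTo (suc n))))

  glue : ℕ → Piece → List ℕ × List ℕ
  glue n (i , A , α , β , w′) = map (embed A) α ++ map (embed (complement n A)) β , replicate i 0 ++ map suc w′

  cut : ℕ → List ℕ × List ℕ → Piece
  cut n (σ , w) = leadingZeros w , filter (_∈? take (leadingZeros w) σ) (oneTo n) ,
                  redP (take (leadingZeros w) σ) , redP (drop (leadingZeros w) σ) , map pred (drop (leadingZeros w) w)

  module Glue {k n i : ℕ} {A α β w′ : List ℕ} (i≤n : i ≤ n) (A⊑ : A ⊑ oneTo n) (length-A : length A ≡ i)
              (α-perm : IsPerm i α) (α-av : Avoider α) (β-perm : IsPerm (n ∸ i) β) (w′∈ : w′ ∈ words k (n ∸ i))
              (βw′-av : BiAvoider (β , w′)) where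

    B : List ℕ
    B = complement n A

    A-increasing : AllPairs _<_ A
    A-increasing = AllPairs-resp-⊒ A⊑ (oneTo-increasing n)

    B-increasing : AllPairs _<_ B
    B-increasing = complement-increasing n A

    α-permA : IsPerm (length A) α
    α-permA = subst (λ m → IsPerm m α) (sym length-A) α-perm

    β-permB : IsPerm (length B) β
    β-permB = subst (λ m → IsPerm m β) (sym (trans (length-complement {n} A⊑) (cong (n ∸_) length-A))) β-perm

    P S σ w : List ℕ
    P = map (embed A) α
    S = map (embed B) β
    σ = P ++ S
    w = replicate i 0 ++ map suc w′

    length-P : length P ≡ i
    length-P = trans (length-map (embed A) α) (IsPerm.length≡ α-perm)

    length-w′ : length w′ ≡ n ∸ i
    length-w′ = proj₁ (∈-words⁻ {k} {n ∸ i} w′∈)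

    σ-perm : IsPerm n σ
    σ-perm = record
      { unique  = Unique.++⁺ (Unique-map-embed A-increasing α-permA) (Unique-map-embed B-increasing β-permB)
                    λ (x∈P , x∈S) → proj₂ (∈-complement⁻ n (map-embed⊆ B-increasing β-permB x∈S))
                                          (map-embed⊆ A-increasing α-permA x∈P)
      ; length≡ = trans (length-++ P) (trans (cong₂ _+_ length-P
                    (trans (length-map (embed B) β) (IsPerm.length≡ β-perm))) (m+[n∸m]≡n i≤n))
      ; ⊆oneTo  = λ x∈ → case-++ (∈-++⁻ P x∈)
      }
      where
      case-++ : ∀ {x} → x ∈ P ⊎ x ∈ S → x ∈ oneTo n
      case-++ (inj₁ x∈P) = lookup A⊑ (map-embed⊆ A-increasing α-permA x∈P)
      case-++ (inj₂ x∈S) = proj₁ (∈-complement⁻ n (map-embed⊆ B-increasing β-permB x∈S))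

    w∈ : w ∈ words (suc k) n
    w∈ = ∈-words⁺ (trans (length-++ (replicate i 0)) (trans (cong₂ _+_ (length-replicate i)
                     (trans (length-map suc w′) length-w′)) (m+[n∸m]≡n i≤n)))
                   (All.++⁺ (All.replicate⁺ i (s≤s z≤n))
                            (All.map⁺ (All.map s≤s (proj₂ (∈-words⁻ {k} {n ∸ i} w′∈)))))

    σw-av : BiAvoider (σ , w)
    σw-av = subst (λ m → BiAvoider (σ , replicate m 0 ++ map suc w′)) length-P
      (biAvoids-++ {j} {Υ} P S w′
        (T-avoids-map {Υ} (embed-isOrderEmbeddingOn A-increasing) (IsPerm.⊆oneTo α-permA) α-av)
        (T-biAvoids-map {Γ} (embed-isOrderEmbeddingOn B-increasing) (IsPerm.⊆oneTo β-permB) βw′-av))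

    glue∈ : (σ , w) ∈ biAvoiders (suc k) n
    glue∈ = ∈-filter⁺ (T? ∘ biAvoids Γ) {xs = wreath (suc k) n}
                      (∈-wreath⁺ {suc k} {n} (∈-perms⁺ σ-perm) w∈) σw-av

    leadingZeros-w : leadingZeros w ≡ i
    leadingZeros-w = leadingZeros-replicate-0-++-map-suc i w′

    take-σ : take i σ ≡ P
    take-σ = subst (λ m → take m σ ≡ P) length-P (take-++ P S)

    drop-σ : drop i σ ≡ S
    drop-σ = subst (λ m → drop m σ ≡ S) length-P (drop-++ P S)

    cut-glue : cut n (σ , w) ≡ (i , A , α , β , w′)
    cut-glue rewrite leadingZeros-w | take-σ | drop-σ =
      cong₂ _,_ refl (cong₂ _,_ A≡ (cong₂ _,_ (redP-map-embed A-increasing α-permA)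
                                   (cong₂ _,_ (redP-map-embed B-increasing β-permB) w′≡)))
      where
      A≡ : filter (_∈? P) (oneTo n) ≡ A
      A≡ = trans (filter-cong-on (_∈? P) (_∈? A) (oneTo n) (λ _ → map-embed⊆ A-increasing α-permA)
                                                       (λ _ → ⊆map-embed A-increasing α-permA))
                 (filter-∈-⊑ A⊑ (Unique-oneTo n))
      w′≡ : map pred (drop i w) ≡ w′
      w′≡ = trans (cong (map pred) (subst (λ m → drop m w ≡ map suc w′) (length-replicate i)
                                         (drop-++ (replicate i 0) (map suc w′))))
                  (trans (sym (map-∘ w′)) (map-id w′))

  module Cut {k n : ℕ} {σ w : List ℕ} (σ-perm : IsPerm n σ) (length-w : length w ≡ n) (w<1+k : All (_< suc k) w)
             (σw-av : BiAvoider (σ , w)) where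

    open IsPerm σ-perm
    open BiAvoidsSplit Υ⊆Sⱼ unique (trans length≡ (sym length-w)) σw-av

    p s A B : List ℕ
    p = take i σ
    s = drop i σ
    A = filter (_∈? p) (oneTo n)
    B = complement n A

    i≤n : i ≤ n
    i≤n = subst (i ≤_) length-w (leadingZeros≤length w)

    p++s≡σ : p ++ s ≡ σ
    p++s≡σ = take++drop≡id i σ

    p-unique : Unique p
    p-unique = Unique.take⁺ i unique

    s-unique : Unique s
    s-unique = Unique.drop⁺ i unique

    length-s : length s ≡ n ∸ i
    length-s = trans (length-drop i σ) (cong (_∸ i) length≡)

    p⊆σ : p ⊆ σ
    p⊆σ x∈ = subst (_ ∈_) p++s≡σ (∈-++⁺ˡ x∈)

    s⊆σ : s ⊆ σ
    s⊆σ x∈ = subst (_ ∈_) p++s≡σ (∈-++⁺ʳ p x∈)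

    A⊆p : A ⊆ p
    A⊆p x∈ = proj₂ (∈-filter⁻ (_∈? p) {xs = oneTo n} x∈)

    p⊆A : p ⊆ A
    p⊆A x∈ = ∈-filter⁺ (_∈? p) (⊆oneTo (p⊆σ x∈)) x∈

    A-increasing : AllPairs _<_ A
    A-increasing = AllPairs.filter⁺ (_∈? p) (oneTo-increasing n)

    length-A : length A ≡ i
    length-A = trans (Unique-length-cong (increasing⇒Unique A-increasing) p-unique A⊆p p⊆A) length-take-i

    s⊆B : s ⊆ B
    s⊆B {x} x∈ = ∈-filter⁺ (¬? ∘ (_∈? A)) (⊆oneTo (s⊆σ x∈))
                   λ x∈A → All.lookup (disjoint (A⊆p x∈A)) x∈ refl
      where
      disjoint : ∀ {x} → x ∈ p → All (x ≢_) s
      disjoint = Unique-++⁻-disjoint p (subst Unique (sym p++s≡σ) unique)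

    B⊆s : B ⊆ s
    B⊆s {x} x∈ with ∈-complement⁻ n x∈
    ... | x∈oneTo , x∉A with ∈-++⁻ p (subst (x ∈_) (sym p++s≡σ) (oneTo⊆ x∈oneTo))
    ...   | inj₁ x∈p = ⊥-elim (x∉A (p⊆A x∈p))
    ...   | inj₂ x∈s = x∈s

    w′∈ : w′ ∈ words k (n ∸ i)
    w′∈ = ∈-words⁺ (trans (length-map pred (drop i w)) (trans (length-drop i w) (cong (_∸ i) length-w)))
      (All.tabulate λ {y} y∈ → ≤-pred (All.lookup w<1+k
        (subst (suc y ∈_) (sym colours≡) (∈-++⁺ʳ (replicate i 0) (∈-map⁺ suc y∈)))))

    cut∈ : cut n (σ , w) ∈ pieces k n
    cut∈ = ∈-pieces⁺ (∈-upTo⁺ (s≤s i≤n))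
      (subst (λ m → A ∈ sublistsOfLength m (oneTo n)) length-A
             (∈-sublistsOfLength⁺ (Sublist.filter-⊆ (_∈? p) (oneTo n))))
      (∈-filter⁺ (T? ∘ avoids Υ) {xs = perms i}
        (∈-perms⁺ (subst (λ m → IsPerm m (redP p)) length-take-i (IsPerm-redP p-unique)))
        (T-avoids-map {Υ} (rank-isOrderEmbeddingOn p) id avoids-take))
      (∈-filter⁺ (T? ∘ biAvoids Γ) {xs = wreath k (n ∸ i)}
        (∈-wreath⁺ {k} {n ∸ i} (∈-perms⁺ (subst (λ m → IsPerm m (redP s)) length-s (IsPerm-redP s-unique))) w′∈)
        (T-biAvoids-map {Γ} (rank-isOrderEmbeddingOn s) id biAvoids-drop))

    glue-cut : glue n (cut n (σ , w)) ≡ (σ , w)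
    glue-cut = cong₂ _,_
      (trans (cong₂ _++_ (map-embed-redP A-increasing p-unique p⊆A A⊆p)
                         (map-embed-redP (complement-increasing n A) s-unique s⊆B B⊆s)) p++s≡σ)
      (sym colours≡)

  AvBi-suc : ∀ k n → AvBi (suc k) Γ n ≡ sum (map (λ i → (n C i) * (Av Υ i * AvBi k Γ (n ∸ i))) (upTo (suc n)))
  AvBi-suc k n = trans
    (sym (length-≡-inverses (glue n) (cut n) (Unique-pieces k n) (Unique.filter⁺ _ (Unique-wreath (suc k) n))
                            glue-inverse cut-inverse))
    (length-pieces k n)
    where
    glue-inverse : ∀ {t} → t ∈ pieces k n → glue n t ∈ biAvoiders (suc k) n × cut n (glue n t) ≡ t
    glue-inverse {i , A , α , β , w′} t∈ =
      let i∈ , A∈ , α∈ , βw′∈ = ∈-pieces⁻ t∈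
          A⊑ , length-A = ∈-sublistsOfLength⁻ i (oneTo n) A∈
          α∈perms , α-av = ∈-filter⁻ (T? ∘ avoids Υ) α∈
          βw′∈wreath , βw′-av = ∈-filter⁻ (T? ∘ biAvoids Γ) {xs = wreath k (n ∸ i)} βw′∈
          β∈perms , w′∈ = ∈-wreath⁻ {k} {n ∸ i} βw′∈wreath
          open Glue {k} (≤-pred (∈-upTo⁻ i∈)) A⊑ length-A (∈-perms⁻ α∈perms) α-av
                        (∈-perms⁻ β∈perms) w′∈ βw′-av
      in glue∈ , cut-glue

    cut-inverse : ∀ {x} → x ∈ biAvoiders (suc k) n → cut n x ∈ pieces k n × glue n (cut n x) ≡ x
    cut-inverse {σ , w} x∈ =
      let x∈wreath , σw-av = ∈-filter⁻ (T? ∘ biAvoids Γ) {xs = wreath (suc k) n} x∈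
          σ∈perms , w∈ = ∈-wreath⁻ {suc k} {n} x∈wreath
          length-w , w<1+k = ∈-words⁻ {suc k} {n} w∈
          open Cut (∈-perms⁻ σ∈perms) length-w w<1+k σw-av
      in cut∈ , glue-cut

  Gamma-colours≢[] : 1 ≤ j → ∀ {γ} → γ ∈ Γ → proj₂ γ ≢ []
  Gamma-colours≢[] 1≤j γ∈ with ∈-Gamma⁻ γ∈
  ... | inj₂ refl           = λ ()
  ... | inj₁ (_ , _ , refl) = replicate≢[] 1≤j
    where
    replicate≢[] : ∀ {m} → 1 ≤ m → replicate m 0 ≢ []
    replicate≢[] (s≤s _) ()

  empty-biAvoider : 1 ≤ j → BiAvoider ([] , [])
  empty-biAvoider 1≤j =
    T-biAvoids⁺ Γ ([] , []) λ { γ∈ (.[] , [] , _ , redW≡) → Gamma-colours≢[] 1≤j γ∈ (sym redW≡) }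

  AvBi-zero-suc : ∀ n → AvBi 0 Γ (suc n) ≡ 0
  AvBi-zero-suc n = n≤0⇒n≡0 (begin
    AvBi 0 Γ (suc n)                                 ≤⟨ length-filter (T? ∘ biAvoids Γ) (wreath 0 (suc n)) ⟩
    length (wreath 0 (suc n))                        ≡⟨ length-pairsWith {h = _,_} {g = λ _ → words 0 (suc n)} (perms (suc n)) ⟩
    sum (map (λ _ → 0) (perms (suc n)))              ≡⟨ sum-map-const (perms (suc n)) 0 ⟩
    length (perms (suc n)) * 0                       ≡⟨ *-zeroʳ (length (perms (suc n))) ⟩
    0                                                ∎)
    where open ≤-Reasoning

  egf-AvBi-zero : 1 ≤ j → ∀ n → egf (AvBi 0 Γ) n ≡ oneS n
  egf-AvBi-zero 1≤j zero    =
    cong (λ m → + m / 1) (cong length (filter-accept (T? ∘ biAvoids Γ) {xs = []} (empty-biAvoider 1≤j)))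
  egf-AvBi-zero 1≤j (suc n) =
    trans (cong (λ m → (+ m / suc n !) {{suc n !≢0}}) (AvBi-zero-suc n)) (0/n≡0 (suc n !) {{suc n !≢0}})

  egf-AvBi-suc : ∀ k n → egf (AvBi (suc k) Γ) n ≡ (egf (Av Υ) ⊛ egf (AvBi k Γ)) n
  egf-AvBi-suc k n = egf-binomial-convolution (Av Υ) (AvBi k Γ) (AvBi (suc k) Γ) {n} (AvBi-suc k n)

theorem5 : (j : ℕ) → 1 ≤ j → (Υ : List (List ℕ)) → All (_∈ perms j) Υ →
           (k : ℕ) → 1 ≤ k →
           (n : ℕ) → egf (AvBi k (Gamma j Υ)) n ≡ (egf (Av Υ) ^S k) n
-- The identity holds for k = 0 as well.
theorem5 j 1≤j Υ Υ⊆Sⱼ k _ = egf-AvBi k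
  where
  open Decomposition {j} Υ⊆Sⱼ
  egf-AvBi : ∀ k n → egf (AvBi k Γ) n ≡ (egf (Av Υ) ^S k) n
  egf-AvBi zero    = egf-AvBi-zero 1≤j
  egf-AvBi (suc k) n = trans (egf-AvBi-suc k n) (⊛-congʳ (egf (Av Υ)) (egf-AvBi k) n)
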